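{- For every DL-Lite$^{\mathcal{H}}_{\mathrm{horn}}$ TBox $\mathcal{T}$ there exists a normal logic program $\Pi_{\mathcal{T}}$ such that for every ABox $\mathcal{A}$, every priority relation $\succ$ for $\mathcal{K}=\langle\mathcal{T},\mathcal{A}\rangle$, and every assertion $\alpha$, the following are equivalent: (1) $\alpha$ belongs to the grounded extension of the PSETAF $F_{\mathcal{K},\succ}$; (2) $\mathtt{acc}(id(\alpha))$ belongs to the well-founded model of $\Pi_{\mathcal{T}}\cup\{\gamma\leftarrow\ \mid\gamma\in\mathcal{A}_{id}\}\cup\{\mathtt{pref}(id(\alpha'),id(\beta'))\leftarrow\ \mid\alpha'\succ\beta'\}$, where $\mathcal{A}_{id}$ is obtained from $\mathcal{A}$ by adding to every assertion $\beta$ an extra final argument holding a unique identifier constant $id(\beta)$.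
   Context: DL-Lite$^{\mathcal{H}}_{\mathrm{horn}}$ TBox axioms: $B_1\sqcap\dots\sqcap B_n\sqsubseteq C$ and $S\sqsubseteq Q$ with $B:=A\mid\exists S$, $C:=B\mid\neg B$, $S:=R\mid R^-$, $Q:=S\mid\neg S$. An ABox is a finite set of assertions $A(a)$, $R(a,b)$. A conflict of $\mathcal{K}$ is an inclusion-minimal $C\subseteq\mathcal{A}$ with $\langle\mathcal{T},C\rangle$ unsatisfiable; $\mathit{conf}(\mathcal{K})$ the set of conflicts; standing assumption: no single assertion is $\mathcal{T}$-inconsistent. A priority relation $\succ$ is an acyclic binary relation on $\mathcal{A}$ with $\alpha\succ\beta$ only if $\{\alpha,\beta\}\subseteq C\in\mathit{conf}(\mathcal{K})$. Grounded extension of $F_{\mathcal{K},\succ}$: let $\rightsquigarrow=\{(C\setminus\{\alpha\},\alpha)\mid C\in\mathit{conf}(\mathcal{K}),\alpha\in C\}$, $S\rightsquigarrow_\succ\alpha$ iff $S\rightsquigarrow\alpha$ and $\alpha\not\succ\beta$ for all $\beta\in S$, $S^+=\{\alpha\mid\exists T\subseteq S,T\rightsquigarrow_\succ\alpha\}$, $\Gamma(S)=\{\alpha\mid\forall T\rightsquigarrow_\succ\alpha,\ T\cap S^+\neq\emptyset\}$; the grounded extension is the least fixpoint of $\Gamma$. Well-founded model of a normal logic program $\Pi$ (rules $h\leftarrow b_1,\dots,b_n,\neg b_{n+1},\dots,\neg b_{n+m}$, grounded over its constants): with $\Pi|_I$ obtained by deleting rules containing $\neg a$ for some $a\in I$ and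 dropping the remaining negative literals, set $I_0=\emptyset$, $I_{j+1}$ the minimal model of $\Pi|_{I_j}$; atoms in the limit $I_*$ of the even iterates are true, atoms outside the limit $I^*$ of the odd iterates are false, the rest unknown. -}

module Defs where

open import Level using (Level; 0ℓ) renaming (suc to lsuc)
open import Data.Nat using (ℕ; zero; suc; _*_)
open import Data.List using (List; []; _∷_; _++_; concatMap; map)
open import Data.List.Membership.Propositional using (_∈_)
open import Data.List.Relation.Binary.Subset.Propositional using (_⊆_)
open import Data.List.Relation.Unary.All using (All)
open import Data.Product using (Σ; ∃; ∃-syntax; _×_; _,_)
open import Data.Sum using (_⊎_)
open import Data.Empty using (⊥)
open import Relation.Nullary using (¬_)
open import Relation.Binary.PropositionalEquality using (_≡_; _≢_)
open import Relation.Binary.Construct.Closure.Transitive using (TransClosure)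

data BasicRole : Set where
  role    : ℕ → BasicRole
  inverse : ℕ → BasicRole

data Role : Set where
  posR : BasicRole → Role
  negR : BasicRole → Role

data BasicConcept : Set where
  atomic : ℕ → BasicConcept
  exists : BasicRole → BasicConcept

data Concept : Set where
  posC : BasicConcept → Concept
  negC : BasicConcept → Concept

-- TBox axioms:  B₁ ⊓ ... ⊓ Bₙ ⊑ C  (n ≥ 1: first conjunct + the rest)
-- and  S ⊑ Q.
data Axiom : Set where
  conceptIncl : BasicConcept → List BasicConcept → Concept → Axiom
  roleIncl    : BasicRole → Role → Axiom

TBox : Set
TBox = List Axiom

data Assertion : Set where
  conceptAs : ℕ → ℕ → Assertion
  roleAs    : ℕ → ℕ → ℕ → Assertion

ABox : Set
ABox = List Assertion

record Interp : Set₁ where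
  field
    Δ    : Set
    indI  : ℕ → Δ
    conI  : ℕ → Δ → Set
    roleI : ℕ → Δ → Δ → Set

module _ (I : Interp) where
  open Interp I

  ⟦_⟧S : BasicRole → Δ → Δ → Set
  ⟦ role R ⟧S x y    = roleI R x y
  ⟦ inverse R ⟧S x y = roleI R y x

  ⟦_⟧Q : Role → Δ → Δ → Set
  ⟦ posR S ⟧Q x y = ⟦ S ⟧S x y
  ⟦ negR S ⟧Q x y = ¬ ⟦ S ⟧S x y

  ⟦_⟧B : BasicConcept → Δ → Set
  ⟦ atomic A ⟧B x = conI A x
  ⟦ exists S ⟧B x = ∃[ y ] ⟦ S ⟧S x y

  ⟦_⟧C : Concept → Δ → Set
  ⟦ posC B ⟧C x = ⟦ B ⟧B x
  ⟦ negC B ⟧C x = ¬ ⟦ B ⟧B x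

  SatAxiom : Axiom → Set
  SatAxiom (conceptIncl B Bs C) =
    ∀ x → ⟦ B ⟧B x → All (λ B′ → ⟦ B′ ⟧B x) Bs → ⟦ C ⟧C x
  SatAxiom (roleIncl S Q) = ∀ x y → ⟦ S ⟧S x y → ⟦ Q ⟧Q x y

  SatAssertion : Assertion → Set
  SatAssertion (conceptAs A a) = conI A (indI a)
  SatAssertion (roleAs R a b)  = roleI R (indI a) (indI b)

Satisfiable : TBox → ABox → Set₁
Satisfiable T A =
  Σ Interp λ I → All (SatAxiom I) T × All (SatAssertion I) A

IsConflict : TBox → ABox → List Assertion → Set₁
IsConflict T A C =
  C ⊆ A × ¬ Satisfiable T C ×
  (∀ C′ → C′ ⊆ C → ¬ Satisfiable T C′ → C ⊆ C′)

NoSelfInconsistent : TBox → ABox → Set₁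
NoSelfInconsistent T A = ∀ α → α ∈ A → Satisfiable T (α ∷ [])

IsPriority : TBox → ABox → (Assertion → Assertion → Set) → Set₁
IsPriority T A _≻_ =
  (∀ α → ¬ TransClosure _≻_ α α) ×
  (∀ α β → α ≻ β → ∃[ C ] (IsConflict T A C × α ∈ C × β ∈ C))

-- Arguments are the assertions of A;
-- an attack  T ⇝ α  is  (C ∖ {α}, α)  for a conflict C ∋ α; it is
-- successful (⇝≻) when α ⊁ β for all β ∈ C ∖ {α}.  Sets of arguments
-- (subsets of the finite A) are represented by lists, up to membership.

module _ (T : TBox) (A : ABox) (_≻_ : Assertion → Assertion → Set) where

  SuccAttack : List Assertion → Assertion → Set₁
  SuccAttack C α =
    IsConflict T A C × α ∈ C × (∀ β → β ∈ C → β ≢ α → ¬ (α ≻ β))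

  Plus : List Assertion → Assertion → Set₁
  Plus S α = ∃[ C ] (SuccAttack C α × (∀ β → β ∈ C → β ≢ α → β ∈ S))

  Γ : List Assertion → Assertion → Set₁
  Γ S α = α ∈ A ×
    (∀ C → SuccAttack C α → ∃[ β ] (β ∈ C × β ≢ α × Plus S β))

  IsFixpoint : List Assertion → Set₁
  IsFixpoint S = ∀ β → (Γ S β → β ∈ S) × (β ∈ S → Γ S β)

  -- membership in the least fixpoint of Γ (the grounded extension):
  -- α lies in every fixpoint of Γ
  InGrounded : Assertion → Set₁
  InGrounded α = ∀ S → IsFixpoint S → α ∈ S

-- Constants: individuals, identifier constants id(β) (one per
-- assertion, hence unique and distinct from everything else), and
-- further constants a program may use.
data Const : Set where
  ind   : ℕ → Const
  ident : Assertion → Const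
  other : ℕ → Const

-- Predicates: concept names (arity 1+1 after adding ids), role names
-- (arity 2+1), acc, pref, and auxiliary predicates.
data Pred : Set where
  conceptP : ℕ → Pred
  roleP    : ℕ → Pred
  acc      : Pred
  pref     : Pred
  auxP     : ℕ → Pred

data Term : Set where
  var : ℕ → Term
  con : Const → Term

record Atom : Set where
  constructor atom
  field
    pred : Pred
    args : List Term

record GAtom : Set where
  constructor gatom
  field
    gpred : Pred
    gargs : List Const

record Rule : Set where
  constructor rule
  field
    head : Atom
    pos  : List Atom
    neg  : List Atom
open Rule public

Program : Set₁
Program = Rule → Set

fact : Atom → Rule
fact h = rule h [] []

termConsts : Term → List Const
termConsts (var _) = []
termConsts (con c) = c ∷ []

atomConsts : Atom → List Const
atomConsts (atom _ ts) = concatMap termConsts ts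

ruleConsts : Rule → List Const
ruleConsts r = concatMap atomConsts (head r ∷ pos r ++ neg r)

ProgConst : Program → Const → Set
ProgConst Π c = ∃[ r ] (Π r × c ∈ ruleConsts r)

groundTerm : (ℕ → Const) → Term → Const
groundTerm σ (var x) = σ x
groundTerm σ (con c) = c

groundAtom : (ℕ → Const) → Atom → GAtom
groundAtom σ (atom p ts) = gatom p (map (groundTerm σ) ts)

groundAtomConsts : (ℕ → Const) → Atom → List Const
groundAtomConsts σ (atom _ ts) = map (groundTerm σ) ts

groundRuleConsts : (ℕ → Const) → Rule → List Const
groundRuleConsts σ r = concatMap (groundAtomConsts σ) (head r ∷ pos r ++ neg r)

-- Minimal model of the reduct Π|_I of ground(Π) (ground(Π): instances
-- of rules of Π over the constants of Π): the least set of ground atoms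
-- closed under the ground rule instances none of whose negative atoms
-- are in I, with negative literals dropped.
data MinModel (Π : Program) (I : GAtom → Set) : GAtom → Set where
  derive : ∀ r (σ : ℕ → Const) a →
    Π r →
    (∀ c → c ∈ groundRuleConsts σ r → ProgConst Π c) →
    (∀ b → b ∈ neg r → ¬ I (groundAtom σ b)) →
    (∀ b → b ∈ pos r → MinModel Π I (groundAtom σ b)) →
    groundAtom σ (head r) ≡ a →
    MinModel Π I a

Iter : Program → ℕ → GAtom → Set
Iter Π zero    a = ⊥
Iter Π (suc j) a = MinModel Π (Iter Π j) a

-- true in the well-founded model: in the limit I_* of the (increasing)
-- even iterates, i.e. in some I_{2j}
WFTrue : Program → GAtom → Set
WFTrue Π a = ∃[ j ] Iter Π (2 * j) a

idAtom : Assertion → Atom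
idAtom γ@(conceptAs A a) = atom (conceptP A) (con (ind a) ∷ con (ident γ) ∷ [])
idAtom γ@(roleAs R a b)  =
  atom (roleP R) (con (ind a) ∷ con (ind b) ∷ con (ident γ) ∷ [])

prefAtom : Assertion → Assertion → Atom
prefAtom α β = atom pref (con (ident α) ∷ con (ident β) ∷ [])

accAtom : Assertion → GAtom
accAtom α = gatom acc (ident α ∷ [])

FullProgram : List Rule → ABox → (Assertion → Assertion → Set) → Program
FullProgram ΠT A _≻_ r =
  r ∈ ΠT ⊎
  (∃[ γ ] (γ ∈ A × r ≡ fact (idAtom γ))) ⊎
  (∃[ α ] ∃[ β ] (α ≻ β × r ≡ fact (prefAtom α β)))

module Submission where

-- Idea.  (1) The grounded extension of F_{K,≻} is the union of the stages
-- Γ¹(∅) ⊆ Γ²(∅) ⊆ …, which become stationary because A is finite.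
-- (2) Every conflict of ⟨T,A⟩ is small and uses only symbols of T: an
-- unsatisfiable ABox contains an unsatisfiable sub-ABox of size bounded by
-- T (via a canonical model), so up to an injective renaming of individuals a
-- conflict is one of finitely many "shapes" over a fixed alphabet.
-- (3) Π_T has, for every shape s and position i of s, a rule deriving
-- defeated(id_i) (a successful attack on the i-th assertion whose attackers
-- are not attacked) and a rule deriving attacked(id_i) (a successful attack
-- whose attackers are accepted); acc(X) ← not defeated(X) closes the loop.
-- Rule instances of Π_T correspond exactly to successful attacks
-- (encode/decode), so the alternating fixpoint iterates I_{2+2j} of the
-- well-founded semantics compute exactly the stages Γ^{j+1}(∅) on acc-atoms.
--
-- Excluded middle (a hypothesis of
-- the theorem) is used to decide conflicts, clashes and stage membership.

open import Defs
open import Level using (0ℓ; _⊔_; Lift; lift) renaming (suc to lsuc)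
open import Function using (_∘_; _⇔_; mk⇔; Equivalence)
open import Data.Nat using (ℕ; zero; suc; _+_; _*_; _∸_; _≤_; _<_; z≤n; s≤s; _≟_)
import Data.Nat.Properties as ℕₚ
open import Data.List
  using (List; []; _∷_; _++_; concatMap; map; length; filter; deduplicate; upTo; downFrom; cartesianProduct)
import Data.List.Properties as Listₚ
open import Data.List.Membership.Propositional using (_∈_; find; lose)
open import Data.List.Membership.Propositional.Properties
  using (∈-++⁺ˡ; ∈-++⁺ʳ; ∈-++⁻; ∈-map⁺; ∈-map⁻; ∈-concatMap⁺; ∈-concatMap⁻; ∈-filter⁺; ∈-filter⁻;
         ∈-deduplicate⁺; ∈-deduplicate⁻; ∈-upTo⁺; ∈-upTo⁻; ∈-downFrom⁺; ∈-downFrom⁻;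
         ∈-cartesianProduct⁺; ∈-cartesianProduct⁻)
open import Data.List.Membership.DecPropositional using () renaming (_∈?_ to member?)
open import Data.List.Relation.Unary.Any using (here; there)
open import Data.List.Relation.Unary.All as All using (All; []; _∷_)
import Data.List.Relation.Unary.All.Properties as Allₚ
open import Data.List.Relation.Unary.AllPairs using ([]; _∷_)
open import Data.List.Relation.Unary.Unique.Propositional using (Unique)
open import Data.List.Relation.Unary.Unique.DecPropositional.Properties using (deduplicate-!)
open import Data.List.Relation.Binary.Subset.Propositional using (_⊆_)
import Data.List.Relation.Binary.Subset.Propositional.Properties as Subsetₚ
import Data.List.Relation.Binary.Sublist.Heterogeneous as Sublist
import Data.List.Relation.Binary.Sublist.Heterogeneous.Properties as Sublistₚ
open import Data.List.Relation.Binary.Pointwise using (Pointwise-≡⇒≡)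
open import Data.Product using (Σ; ∃; ∃-syntax; _×_; _,_; proj₁; proj₂)
open import Data.Sum using (_⊎_; inj₁; inj₂)
open import Data.Empty using (⊥; ⊥-elim)
open import Relation.Nullary using (¬_; Dec; yes; no; ¬?)
open import Relation.Unary using (Decidable)
open import Relation.Binary.PropositionalEquality
  using (_≡_; _≢_; refl; sym; trans; cong; cong₂; subst; subst₂)
open import Axiom.ExcludedMiddle using (ExcludedMiddle)

EM : Set₂
EM = ExcludedMiddle (lsuc 0ℓ)

decide : EM → (P : Set) → Dec P
decide em P with em {Lift (lsuc 0ℓ) P}
... | yes (lift p) = yes p
... | no ¬p = no (λ p → ¬p (lift p))

_≟ₐ_ : (x y : Assertion) → Dec (x ≡ y)
conceptAs A a ≟ₐ conceptAs A′ a′ with A ≟ A′ | a ≟ a′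
... | yes refl | yes refl = yes refl
... | no A≢A′  | _        = no λ { refl → A≢A′ refl }
... | _        | no a≢a′  = no λ { refl → a≢a′ refl }
conceptAs _ _ ≟ₐ roleAs _ _ _ = no λ ()
roleAs _ _ _ ≟ₐ conceptAs _ _ = no λ ()
roleAs R a b ≟ₐ roleAs R′ a′ b′ with R ≟ R′ | a ≟ a′ | b ≟ b′
... | yes refl | yes refl | yes refl = yes refl
... | no R≢R′  | _        | _        = no λ { refl → R≢R′ refl }
... | _        | no a≢a′  | _        = no λ { refl → a≢a′ refl }
... | _        | _        | no b≢b′  = no λ { refl → b≢b′ refl }

module _ {X Y : Set} (f : X → List Y) where

  concatMap-∈⁺ : ∀ {xs x y} → x ∈ xs → y ∈ f x → y ∈ concatMap f xs
  concatMap-∈⁺ x∈ y∈ = ∈-concatMap⁺ f (lose x∈ y∈)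

  concatMap-∈⁻ : ∀ xs {y} → y ∈ concatMap f xs → ∃[ x ] x ∈ xs × y ∈ f x
  concatMap-∈⁻ xs y∈ = find (∈-concatMap⁻ f {xs} y∈)

  length-concatMap-≤ : (∀ x → length (f x) ≤ 1) → ∀ xs → length (concatMap f xs) ≤ length xs
  length-concatMap-≤ f≤1 [] = z≤n
  length-concatMap-≤ f≤1 (x ∷ xs) = ℕₚ.≤-trans (ℕₚ.≤-reflexive (Listₚ.length-++ (f x)))
    (ℕₚ.+-mono-≤ (f≤1 x) (length-concatMap-≤ f≤1 xs))

-- List indexing with a default value; positions are natural numbers because
-- they double as variable names in the program Π_T.
nth : {X : Set} → X → List X → ℕ → X
nth d [] _ = d
nth d (x ∷ xs) zero = x
nth d (x ∷ xs) (suc k) = nth d xs k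

module _ {X : Set} (d : X) where

  nth-∈ : ∀ xs {k} → k < length xs → nth d xs k ∈ xs
  nth-∈ (x ∷ xs) {zero} _ = here refl
  nth-∈ (x ∷ xs) {suc k} (s≤s k<) = there (nth-∈ xs k<)

  ∈-nth : ∀ xs {x} → x ∈ xs → ∃[ k ] k < length xs × nth d xs k ≡ x
  ∈-nth (y ∷ xs) (here refl) = 0 , s≤s z≤n , refl
  ∈-nth (y ∷ xs) (there x∈) with ∈-nth xs x∈
  ... | k , k< , eq = suc k , s≤s k< , eq

  nth-map : ∀ {Y : Set} (d′ : Y) (f : X → Y) xs {k} → k < length xs → nth d′ (map f xs) k ≡ f (nth d xs k)
  nth-map d′ f (x ∷ xs) {zero} _ = refl
  nth-map d′ f (x ∷ xs) {suc k} (s≤s k<) = nth-map d′ f xs k<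

  nth-injective : ∀ xs → Unique xs → ∀ {u v} → u < length xs → v < length xs →
                  nth d xs u ≡ nth d xs v → u ≡ v
  nth-injective (x ∷ xs) (x∉ ∷ !xs) {zero} {zero} _ _ _ = refl
  nth-injective (x ∷ xs) (x∉ ∷ !xs) {zero} {suc v} _ (s≤s v<) eq =
    ⊥-elim (All.lookup x∉ (nth-∈ xs v<) eq)
  nth-injective (x ∷ xs) (x∉ ∷ !xs) {suc u} {zero} (s≤s u<) _ eq =
    ⊥-elim (All.lookup x∉ (nth-∈ xs u<) (sym eq))
  nth-injective (x ∷ xs) (x∉ ∷ !xs) {suc u} {suc v} (s≤s u<) (s≤s v<) eq =
    cong suc (nth-injective xs !xs u< v< eq)

indexOf : List ℕ → ℕ → ℕ
indexOf [] n = 0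
indexOf (x ∷ xs) n with x ≟ n
... | yes _ = 0
... | no _ = suc (indexOf xs n)

indexOf-correct : ∀ xs {n} → n ∈ xs → indexOf xs n < length xs × nth 0 xs (indexOf xs n) ≡ n
indexOf-correct (x ∷ xs) {n} n∈ with x ≟ n
... | yes x≡n = s≤s z≤n , x≡n
indexOf-correct (x ∷ xs) (here refl) | no x≢n = ⊥-elim (x≢n refl)
indexOf-correct (x ∷ xs) (there n∈) | no _ with indexOf-correct xs n∈
... | k< , eq = s≤s k< , eq

-- All lists of length at most n over an alphabet; the set of conflict shapes
-- is carved out of this finite enumeration.
listsUpTo : {X : Set} → ℕ → List X → List (List X)
listsUpTo zero alphabet = [] ∷ []
listsUpTo (suc n) alphabet = [] ∷ concatMap (λ x → map (x ∷_) (listsUpTo n alphabet)) alphabet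

module _ {X : Set} (alphabet : List X) where

  listsUpTo-∈⁺ : ∀ n xs → All (_∈ alphabet) xs → length xs ≤ n → xs ∈ listsUpTo n alphabet
  listsUpTo-∈⁺ zero [] _ _ = here refl
  listsUpTo-∈⁺ (suc n) [] _ _ = here refl
  listsUpTo-∈⁺ (suc n) (x ∷ xs) (x∈ ∷ xs⊆) (s≤s len) =
    there (concatMap-∈⁺ _ x∈ (∈-map⁺ (x ∷_) (listsUpTo-∈⁺ n xs xs⊆ len)))

  listsUpTo-∈⁻ : ∀ n xs → xs ∈ listsUpTo n alphabet → All (_∈ alphabet) xs × length xs ≤ n
  listsUpTo-∈⁻ n [] _ = [] , z≤n
  listsUpTo-∈⁻ zero (x ∷ xs) (here ())
  listsUpTo-∈⁻ zero (x ∷ xs) (there ())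
  listsUpTo-∈⁻ (suc n) (x ∷ xs) (there xs∈) with concatMap-∈⁻ _ alphabet xs∈
  ... | y , y∈ , ∈map with ∈-map⁻ (y ∷_) ∈map
  ... | ys , ys∈ , refl with listsUpTo-∈⁻ n ys ys∈
  ... | ys⊆ , len = (y∈ ∷ ys⊆) , s≤s len

-- An increasing chain P 0 ⊆ P 1 ⊆ … of decidable predicates becomes stationary
-- on a finite list xs: the sub-lists filter (P j) xs grow strictly until they
-- stop growing, so this happens within length xs + 1 steps.
module _ {ℓ} {X : Set} (xs : List X) (P : ℕ → X → Set ℓ) (P? : ∀ j → Decidable (P j))
         (mono : ∀ j {x} → P j x → P (suc j) x) where

  private
    Stage : ℕ → List X
    Stage j = filter (P? j) xs

    Stable : ℕ → Set ℓ
    Stable j = ∀ x → x ∈ xs → P (suc j) x → P j x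

    stage-⊑ : ∀ j → Sublist.Sublist _≡_ (Stage j) (Stage (suc j))
    stage-⊑ j = Sublistₚ.⊆-filter-Sublist (P? j) (P? (suc j)) (λ { refl → mono j }) (Sublistₚ.refl refl {xs})

    -- Either the chain has become stationary, or the j-th stage has ≥ j elements.
    grow : ∀ n → (∃ Stable) ⊎ (n ≤ length (Stage n))
    grow zero = inj₂ z≤n
    grow (suc n) with grow n
    ... | inj₁ stable = inj₁ stable
    ... | inj₂ n≤ with length (Stage n) ≟ length (Stage (suc n))
    ... | no len≢ =
      inj₂ (ℕₚ.≤-trans (s≤s n≤) (ℕₚ.≤∧≢⇒< (Sublistₚ.length-mono-≤ (stage-⊑ n)) len≢))
    ... | yes len≡ = inj₁ (n , stable)
      where
      same : Stage n ≡ Stage (suc n)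
      same = Pointwise-≡⇒≡ (Sublistₚ.toPointwise len≡ (stage-⊑ n))
      stable : Stable n
      stable x x∈ px =
        proj₂ (∈-filter⁻ (P? n) {xs = xs} (subst (x ∈_) (sym same) (∈-filter⁺ (P? (suc n)) x∈ px)))

  chain-stabilises : ∃[ j ] (∀ x → x ∈ xs → P (suc j) x → P j x)
  chain-stabilises with grow (suc (length xs))
  ... | inj₁ stable = stable
  ... | inj₂ too-big = ⊥-elim (ℕₚ.<-irrefl refl (ℕₚ.≤-trans too-big (Listₚ.length-filter (P? _) xs)))


-- The grounded extension as the union of the stages Γ^j(∅).  Γ is
-- generalised to arbitrary predicates P (Defended P), so that stages can be
-- defined by recursion; Γ T A _≻_ S is definitionally Defended (_∈ S).
module Grounded (em : EM) (T : TBox) (A : ABox) (_≻_ : Assertion → Assertion → Set) where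

  Attack : List Assertion → Assertion → Set₁
  Attack = SuccAttack T A _≻_

  CounteredBy : ∀ {ℓ} → (Assertion → Set ℓ) → Assertion → Set (lsuc 0ℓ ⊔ ℓ)
  CounteredBy P β = ∃[ C ] (Attack C β × (∀ β′ → β′ ∈ C → β′ ≢ β → P β′))

  Defended : ∀ {ℓ} → (Assertion → Set ℓ) → Assertion → Set (lsuc 0ℓ ⊔ ℓ)
  Defended P α = α ∈ A × (∀ C → Attack C α → ∃[ β ] (β ∈ C × β ≢ α × CounteredBy P β))

  -- Defended is monotone (only attackers, which lie in A, are inspected).
  Defended-mono : ∀ {ℓ ℓ′} {P : Assertion → Set ℓ} {Q : Assertion → Set ℓ′} →
    (∀ x → x ∈ A → P x → Q x) → ∀ {α} → Defended P α → Defended Q α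
  Defended-mono {P = P} {Q} P⇒Q (α∈ , defend) = α∈ , λ C att → counter (defend C att)
    where
    counter : ∀ {C α} → ∃[ β ] (β ∈ C × β ≢ α × CounteredBy P β) →
                        ∃[ β ] (β ∈ C × β ≢ α × CounteredBy Q β)
    counter (β , β∈ , β≢ , C′ , att′ , attackers) =
      β , β∈ , β≢ , C′ , att′ , λ γ γ∈ γ≢ → P⇒Q γ (proj₁ (proj₁ att′) γ∈) (attackers γ γ∈ γ≢)

  stage : ℕ → Assertion → Set₁
  stage zero _ = Lift (lsuc 0ℓ) ⊥
  stage (suc j) = Defended (stage j)

  stage-mono : ∀ j {α} → stage j α → stage (suc j) α
  stage-mono zero ()
  stage-mono (suc j) = Defended-mono (λ x _ → stage-mono j)

  stage⊆fixpoint : ∀ S → IsFixpoint T A _≻_ S → ∀ j {α} → stage j α → α ∈ S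
  stage⊆fixpoint S fixpoint zero ()
  stage⊆fixpoint S fixpoint (suc j) {α} in-stage =
    proj₁ (fixpoint α) (Defended-mono (λ x _ → stage⊆fixpoint S fixpoint j) in-stage)

  -- α is in the grounded extension iff it belongs to some stage: the stationary
  -- stage (which exists by finiteness of A) is itself a fixpoint of Γ.
  grounded⇔stage : ∀ α → InGrounded T A _≻_ α ⇔ (∃[ j ] stage j α)
  grounded⇔stage α = mk⇔ grounded→stage (λ (j , in-stage) S fixpoint → stage⊆fixpoint S fixpoint j in-stage)
    where
    stable : ∃[ j ] (∀ x → x ∈ A → stage (suc j) x → stage j x)
    stable = chain-stabilises A stage (λ j α → em) stage-mono
    j : ℕ
    j = proj₁ stable
    inStage? : Decidable (stage j)
    inStage? α = em
    S : List Assertion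
    S = filter inStage? A
    S⊆stage : ∀ {x} → x ∈ S → stage j x
    S⊆stage x∈S = proj₂ (∈-filter⁻ inStage? {xs = A} x∈S)
    S-fixpoint : IsFixpoint T A _≻_ S
    S-fixpoint β = closed , defended
      where
      closed : Γ T A _≻_ S β → β ∈ S
      closed Γβ = ∈-filter⁺ inStage? (proj₁ Γβ)
        (proj₂ stable β (proj₁ Γβ) (Defended-mono (λ x _ → S⊆stage) Γβ))
      defended : β ∈ S → Γ T A _≻_ S β
      defended β∈S = Defended-mono (λ x x∈A → ∈-filter⁺ inStage? x∈A) (stage-mono j (S⊆stage β∈S))
    grounded→stage : InGrounded T A _≻_ α → ∃[ j ] stage j α
    grounded→stage grounded = j , S⊆stage (grounded S S-fixpoint)

inv : BasicRole → BasicRole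
inv (role R) = inverse R
inv (inverse R) = role R

inv-inv : ∀ S → inv (inv S) ≡ S
inv-inv (role R) = refl
inv-inv (inverse R) = refl

roleName : BasicRole → ℕ
roleName (role R) = R
roleName (inverse R) = R

roleName-inv : ∀ S → roleName (inv S) ≡ roleName S
roleName-inv (role R) = refl
roleName-inv (inverse R) = refl

basicOf : Concept → BasicConcept
basicOf (posC B) = B
basicOf (negC B) = B

basicRoleOf : Role → BasicRole
basicRoleOf (posR S) = S
basicRoleOf (negR S) = S

conceptNamesB roleNamesB : BasicConcept → List ℕ
conceptNamesB (atomic A) = A ∷ []
conceptNamesB (exists S) = []
roleNamesB (atomic A) = []
roleNamesB (exists S) = roleName S ∷ []

conceptNamesAx roleNamesAx : Axiom → List ℕ
conceptNamesAx (conceptIncl B Bs C) =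
  conceptNamesB B ++ concatMap conceptNamesB Bs ++ conceptNamesB (basicOf C)
conceptNamesAx (roleIncl S Q) = []
roleNamesAx (conceptIncl B Bs C) =
  roleNamesB B ++ concatMap roleNamesB Bs ++ roleNamesB (basicOf C)
roleNamesAx (roleIncl S Q) = roleName S ∷ roleName (basicRoleOf Q) ∷ []

conceptNames roleNames : TBox → List ℕ
conceptNames = concatMap conceptNamesAx
roleNames = concatMap roleNamesAx

InSig : TBox → BasicConcept → Set
InSig T (atomic A) = A ∈ conceptNames T
InSig T (exists S) = roleName S ∈ roleNames T

InSigₐ : TBox → Assertion → Set
InSigₐ T (conceptAs A a) = A ∈ conceptNames T
InSigₐ T (roleAs R a b) = R ∈ roleNames T

module _ {T : TBox} where

  private
    InSig-from : ∀ {ax} → ax ∈ T → ∀ B →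
      (∀ {n} → n ∈ conceptNamesB B → n ∈ conceptNamesAx ax) →
      (∀ {n} → n ∈ roleNamesB B → n ∈ roleNamesAx ax) → InSig T B
    InSig-from ax∈ (atomic A) c r = concatMap-∈⁺ conceptNamesAx ax∈ (c (here refl))
    InSig-from ax∈ (exists S) c r = concatMap-∈⁺ roleNamesAx ax∈ (r (here refl))

  InSig-lhs : ∀ {B Bs C} → conceptIncl B Bs C ∈ T → InSig T B
  InSig-lhs ax∈ = InSig-from ax∈ _ ∈-++⁺ˡ ∈-++⁺ˡ

  InSig-conj : ∀ {B Bs C B′} → conceptIncl B Bs C ∈ T → B′ ∈ Bs → InSig T B′
  InSig-conj {B} {Bs} ax∈ B′∈ = InSig-from ax∈ _
    (λ n∈ → ∈-++⁺ʳ (conceptNamesB B) (∈-++⁺ˡ (concatMap-∈⁺ conceptNamesB B′∈ n∈)))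
    (λ n∈ → ∈-++⁺ʳ (roleNamesB B) (∈-++⁺ˡ (concatMap-∈⁺ roleNamesB B′∈ n∈)))

  InSig-rhs : ∀ {B Bs C} → conceptIncl B Bs C ∈ T → InSig T (basicOf C)
  InSig-rhs {B} {Bs} ax∈ = InSig-from ax∈ _
    (∈-++⁺ʳ (conceptNamesB B) ∘ ∈-++⁺ʳ (concatMap conceptNamesB Bs))
    (∈-++⁺ʳ (roleNamesB B) ∘ ∈-++⁺ʳ (concatMap roleNamesB Bs))

  InSig-roleLhs : ∀ {S Q} → roleIncl S Q ∈ T → roleName S ∈ roleNames T
  InSig-roleLhs ax∈ = concatMap-∈⁺ roleNamesAx ax∈ (here refl)

  InSig-roleRhs : ∀ {S Q} → roleIncl S Q ∈ T → roleName (basicRoleOf Q) ∈ roleNames T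
  InSig-roleRhs ax∈ = concatMap-∈⁺ roleNamesAx ax∈ (there (here refl))

data RoleSub (T : TBox) : BasicRole → BasicRole → Set where
  sub-refl : ∀ {S} → RoleSub T S S
  sub-step : ∀ {S S′ Q} → roleIncl S′ (posR Q) ∈ T → RoleSub T S S′ → RoleSub T S Q
  sub-stepInv : ∀ {S S′ Q} → roleIncl S′ (posR Q) ∈ T → RoleSub T S (inv S′) → RoleSub T S (inv Q)

RoleSub-inv : ∀ {T S Q} → RoleSub T S Q → RoleSub T (inv S) (inv Q)
RoleSub-inv sub-refl = sub-refl
RoleSub-inv (sub-step ax s) = sub-stepInv ax (RoleSub-inv s)
RoleSub-inv {T} {S} (sub-stepInv {S′ = S′} {Q = Q} ax s) =
  subst (RoleSub T (inv S)) (sym (inv-inv Q))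
        (sub-step ax (subst (RoleSub T (inv S)) (inv-inv S′) (RoleSub-inv s)))

RoleSub-invʳ : ∀ {T S Q} → RoleSub T S (inv Q) → RoleSub T (inv S) Q
RoleSub-invʳ {T} {S} {Q} s = subst (RoleSub T (inv S)) (inv-inv Q) (RoleSub-inv s)

RoleSub-sig : ∀ {T S Q} → RoleSub T S Q → roleName Q ∈ roleNames T → roleName S ∈ roleNames T
RoleSub-sig sub-refl Q∈ = Q∈
RoleSub-sig (sub-step ax s) _ = RoleSub-sig s (InSig-roleLhs ax)
RoleSub-sig {T} (sub-stepInv {S′ = S′} ax s) _ =
  RoleSub-sig s (subst (_∈ roleNames T) (sym (roleName-inv S′)) (InSig-roleLhs ax))

-- Elements of the canonical model: an individual followed by the path of
-- anonymous role successors leading to the element.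
Elem : Set
Elem = ℕ × List BasicRole

-- Der x B: x provably belongs to B; Reach x:
-- x is generated; Link S x y: (x, y) provably belongs to S; Clash: a negative
-- inclusion is violated.  ⟨T, C⟩ is satisfiable iff there is no clash.
module Canonical (T : TBox) (C : ABox) where

  data Der : Elem → BasicConcept → Set where
    der-concept : ∀ {A a} → conceptAs A a ∈ C → Der (a , []) (atomic A)
    der-exists : ∀ {R a b} → roleAs R a b ∈ C → Der (a , []) (exists (role R))
    der-existsInv : ∀ {R a b} → roleAs R a b ∈ C → Der (b , []) (exists (inverse R))
    der-witness : ∀ {a p S} → Der (a , S ∷ p) (exists (inv S))
    der-conceptIncl : ∀ {x B Bs B′} → conceptIncl B Bs (posC B′) ∈ T →
                      Der x B → All (Der x) Bs → Der x B′
    der-roleIncl : ∀ {x S Q} → roleIncl S (posR Q) ∈ T → Der x (exists S) → Der x (exists Q)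
    der-roleInclInv : ∀ {x S Q} → roleIncl S (posR Q) ∈ T →
                      Der x (exists (inv S)) → Der x (exists (inv Q))

  data Reach : Elem → Set where
    reach-ind : ∀ {a} → Reach (a , [])
    reach-succ : ∀ {a p S} → Reach (a , p) → roleName S ∈ roleNames T →
                 Der (a , p) (exists S) → Reach (a , S ∷ p)

  data Link (S : BasicRole) : Elem → Elem → Set where
    link-as : ∀ {R a b} → roleAs R a b ∈ C → RoleSub T (role R) S → Link S (a , []) (b , [])
    link-asInv : ∀ {R a b} → roleAs R b a ∈ C → RoleSub T (inverse R) S → Link S (a , []) (b , [])
    link-succ : ∀ {S′ a p} → RoleSub T S′ S → Link S (a , p) (a , S′ ∷ p)
    link-pred : ∀ {S′ a p} → RoleSub T S′ (inv S) → Link S (a , S′ ∷ p) (a , p)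

  data Clash : Set where
    clash-concept : ∀ {x B Bs B′} → Reach x → conceptIncl B Bs (negC B′) ∈ T →
                    Der x B → All (Der x) Bs → Der x B′ → Clash
    clash-role : ∀ {x y S Q} → Reach x → Reach y → roleIncl S (negR Q) ∈ T →
                 Link S x y → Link Q x y → Clash

  Der-sub : ∀ {x S Q} → Der x (exists S) → RoleSub T S Q → Der x (exists Q)
  Der-sub d sub-refl = d
  Der-sub d (sub-step ax s) = der-roleIncl ax (Der-sub d s)
  Der-sub d (sub-stepInv ax s) = der-roleInclInv ax (Der-sub d s)

  Link-inv : ∀ {S x y} → Link S x y → Link (inv S) y x
  Link-inv (link-as m s) = link-asInv m (RoleSub-inv s)
  Link-inv (link-asInv m s) = link-as m (RoleSub-inv s)
  Link-inv {S} (link-succ {S′} s) = link-pred (subst (RoleSub T S′) (sym (inv-inv S)) s)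
  Link-inv (link-pred s) = link-succ s

  Link-roleIncl : ∀ {S Q x y} → Link S x y → roleIncl S (posR Q) ∈ T → Link Q x y
  Link-roleIncl (link-as m s) ax = link-as m (sub-step ax s)
  Link-roleIncl (link-asInv m s) ax = link-asInv m (sub-step ax s)
  Link-roleIncl (link-succ s) ax = link-succ (sub-step ax s)
  Link-roleIncl (link-pred s) ax = link-pred (sub-stepInv ax s)

  Link→Der : ∀ {S x y} → Reach y → Link S x y → Der x (exists S)
  Link→Der _ (link-as m s) = Der-sub (der-exists m) s
  Link→Der _ (link-asInv m s) = Der-sub (der-existsInv m) s
  Link→Der (reach-succ r S′∈ d) (link-succ s) = Der-sub d s
  Link→Der _ (link-pred s) = Der-sub der-witness (RoleSub-invʳ s)

  canonical : Interp
  canonical = record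
    { Δ = Σ Elem Reach
    ; indI = λ a → (a , []) , reach-ind
    ; conI = λ A x → Der (proj₁ x) (atomic A)
    ; roleI = λ R x y → Link (role R) (proj₁ x) (proj₁ y)
    }

  private
    Dom : Set
    Dom = Σ Elem Reach

    ⟦S⟧→Link : ∀ S (x y : Dom) → ⟦_⟧S canonical S x y → Link S (proj₁ x) (proj₁ y)
    ⟦S⟧→Link (role R) x y r = r
    ⟦S⟧→Link (inverse R) x y r = Link-inv r

    Link→⟦S⟧ : ∀ S (x y : Dom) → Link S (proj₁ x) (proj₁ y) → ⟦_⟧S canonical S x y
    Link→⟦S⟧ (role R) x y r = r
    Link→⟦S⟧ (inverse R) x y r = Link-inv r

    ⟦B⟧→Der : ∀ B (x : Dom) → ⟦_⟧B canonical B x → Der (proj₁ x) B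
    ⟦B⟧→Der (atomic A) x d = d
    ⟦B⟧→Der (exists S) x (y , r) = Link→Der (proj₂ y) (⟦S⟧→Link S x y r)

    Der→⟦B⟧ : ∀ B (x : Dom) → InSig T B → Der (proj₁ x) B → ⟦_⟧B canonical B x
    Der→⟦B⟧ (atomic A) x _ d = d
    Der→⟦B⟧ (exists S) ((a , p) , rx) S∈ d =
      ((a , S ∷ p) , reach-succ rx S∈ d) , Link→⟦S⟧ S _ _ (link-succ sub-refl)

    ⟦Bs⟧→Der : ∀ Bs (x : Dom) → All (λ B → ⟦_⟧B canonical B x) Bs → All (Der (proj₁ x)) Bs
    ⟦Bs⟧→Der Bs x = All.map (λ {B} → ⟦B⟧→Der B x)

  canonical-model : ¬ Clash → Satisfiable T C
  canonical-model noClash = canonical , All.tabulate (λ {ax} → satAxiom ax) , All.tabulate (λ {γ} → satAs γ)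
    where
    satAxiom : ∀ ax → ax ∈ T → SatAxiom canonical ax
    satAxiom (conceptIncl B Bs (posC B′)) ax∈ x b bs =
      Der→⟦B⟧ B′ x (InSig-rhs ax∈) (der-conceptIncl ax∈ (⟦B⟧→Der B x b) (⟦Bs⟧→Der Bs x bs))
    satAxiom (conceptIncl B Bs (negC B′)) ax∈ x b bs b′ =
      noClash (clash-concept (proj₂ x) ax∈ (⟦B⟧→Der B x b) (⟦Bs⟧→Der Bs x bs) (⟦B⟧→Der B′ x b′))
    satAxiom (roleIncl S (posR Q)) ax∈ x y r = Link→⟦S⟧ Q x y (Link-roleIncl (⟦S⟧→Link S x y r) ax∈)
    satAxiom (roleIncl S (negR Q)) ax∈ x y r q =
      noClash (clash-role (proj₂ x) (proj₂ y) ax∈ (⟦S⟧→Link S x y r) (⟦S⟧→Link Q x y q))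
    satAs : ∀ γ → γ ∈ C → SatAssertion canonical γ
    satAs (conceptAs A a) γ∈ = der-concept γ∈
    satAs (roleAs R a b) γ∈ = link-as γ∈ sub-refl

  -- Soundness: every model of ⟨T, C⟩ contains a homomorphic image of the
  -- generated elements satisfying all derived facts, so no clash can occur.
  module _ (I : Interp) (satT : All (SatAxiom I) T) (satC : All (SatAssertion I) C) where
    open Interp I

    private
      inv→ : ∀ S {u v} → ⟦_⟧S I (inv S) u v → ⟦_⟧S I S v u
      inv→ (role R) r = r
      inv→ (inverse R) r = r

      →inv : ∀ S {u v} → ⟦_⟧S I S v u → ⟦_⟧S I (inv S) u v
      →inv (role R) r = r
      →inv (inverse R) r = r

      axiom : ∀ {ax} → ax ∈ T → SatAxiom I ax
      axiom = All.lookup satT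

      RoleSub-sound : ∀ {S Q} → RoleSub T S Q → ∀ {u v} → ⟦_⟧S I S u v → ⟦_⟧S I Q u v
      RoleSub-sound sub-refl r = r
      RoleSub-sound (sub-step ax s) r = axiom ax _ _ (RoleSub-sound s r)
      RoleSub-sound (sub-stepInv {S′ = S′} {Q = Q} ax s) r =
        →inv Q (axiom ax _ _ (inv→ S′ (RoleSub-sound s r)))

      mutual
        image : ∀ {x} → Reach x → Δ
        image (reach-ind {a}) = indI a
        image (reach-succ r _ d) = proj₁ (Der-sound r d)

        Der-sound : ∀ {x B} (r : Reach x) → Der x B → ⟦_⟧B I B (image r)
        Der-sound reach-ind (der-concept m) = All.lookup satC m
        Der-sound reach-ind (der-exists {b = b} m) = indI b , All.lookup satC m
        Der-sound reach-ind (der-existsInv {a = a} m) = indI a , All.lookup satC m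
        Der-sound (reach-succ {S = S} r _ d) der-witness = image r , →inv S (proj₂ (Der-sound r d))
        Der-sound r (der-conceptIncl ax d ds) = axiom ax _ (Der-sound r d) (Ders-sound r ds)
        Der-sound r (der-roleIncl ax d) with Der-sound r d
        ... | y , q = y , axiom ax _ _ q
        Der-sound r (der-roleInclInv {S = S} {Q = Q} ax d) with Der-sound r d
        ... | y , q = y , →inv Q (axiom ax _ _ (inv→ S q))

        Ders-sound : ∀ {x Bs} (r : Reach x) → All (Der x) Bs → All (λ B → ⟦_⟧B I B (image r)) Bs
        Ders-sound r [] = []
        Ders-sound r (d ∷ ds) = Der-sound r d ∷ Ders-sound r ds

      Link-as-sound : ∀ {S a b} → Link S (a , []) (b , []) → ⟦_⟧S I S (indI a) (indI b)
      Link-as-sound (link-as m s) = RoleSub-sound s (All.lookup satC m)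
      Link-as-sound (link-asInv m s) = RoleSub-sound s (All.lookup satC m)

    no-clash : ¬ Clash
    no-clash (clash-concept r ax d ds d′) = axiom ax _ (Der-sound r d) (Ders-sound r ds) (Der-sound r d′)
    no-clash (clash-role reach-ind reach-ind ax r q) = axiom ax _ _ (Link-as-sound r) (Link-as-sound q)
    no-clash (clash-role rx (reach-succ ry _ d) ax (link-succ s₁) (link-succ s₂)) =
      axiom ax _ _ (RoleSub-sound s₁ (proj₂ (Der-sound ry d))) (RoleSub-sound s₂ (proj₂ (Der-sound ry d)))
    no-clash (clash-role {S = S} {Q = Q} (reach-succ rx _ d) ry ax (link-pred s₁) (link-pred s₂)) =
      axiom ax _ _ (inv→ S (RoleSub-sound s₁ (proj₂ (Der-sound rx d))))
                   (inv→ Q (RoleSub-sound s₂ (proj₂ (Der-sound rx d))))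

  clash-unsat : Clash → ¬ Satisfiable T C
  clash-unsat c (I , satT , satC) = no-clash I satT satC c

sigBasics : TBox → List BasicConcept
sigBasics T = map atomic (conceptNames T) ++
  (map (exists ∘ role) (roleNames T) ++ map (exists ∘ inverse) (roleNames T))

InSig→sigBasics : ∀ T B → InSig T B → B ∈ sigBasics T
InSig→sigBasics T (atomic A) A∈ = ∈-++⁺ˡ (∈-map⁺ atomic A∈)
InSig→sigBasics T (exists (role R)) R∈ =
  ∈-++⁺ʳ (map atomic (conceptNames T)) (∈-++⁺ˡ (∈-map⁺ (exists ∘ role) R∈))
InSig→sigBasics T (exists (inverse R)) R∈ =
  ∈-++⁺ʳ (map atomic (conceptNames T))
    (∈-++⁺ʳ (map (exists ∘ role) (roleNames T)) (∈-map⁺ (exists ∘ inverse) R∈))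

sigBasics→InSig : ∀ T B → B ∈ sigBasics T → InSig T B
sigBasics→InSig T B B∈ with ∈-++⁻ (map atomic (conceptNames T)) B∈
... | inj₁ B∈′ with ∈-map⁻ atomic B∈′
...   | A , A∈ , refl = A∈
sigBasics→InSig T B B∈ | inj₂ B∈′ with ∈-++⁻ (map (exists ∘ role) (roleNames T)) B∈′
... | inj₁ B∈″ with ∈-map⁻ (exists ∘ role) B∈″
...   | R , R∈ , refl = R∈
sigBasics→InSig T B B∈ | inj₂ B∈′ | inj₂ B∈″ with ∈-map⁻ (exists ∘ inverse) B∈″
...   | R , R∈ , refl = R∈

Witness : ℕ → BasicConcept → Assertion → Set
Witness a (atomic A) γ = γ ≡ conceptAs A a
Witness a (exists (role R)) γ = ∃[ b ] γ ≡ roleAs R a b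
Witness a (exists (inverse R)) γ = ∃[ b ] γ ≡ roleAs R b a

Witness-sig : ∀ T a B γ → InSig T B → Witness a B γ → InSigₐ T γ
Witness-sig T a (atomic A) γ A∈ refl = A∈
Witness-sig T a (exists (role R)) γ R∈ (b , refl) = R∈
Witness-sig T a (exists (inverse R)) γ R∈ (b , refl) = R∈

-- Derivations about the elements rooted at an individual a only use the
-- assertions that directly witness a basic concept for a; if D contains a
-- witness for every such concept witnessed in C, these derivations carry
-- over from C to D.
module Transfer (T : TBox) (C D : ABox) (a : ℕ)
  (covers : ∀ B → InSig T B → ∀ γ → γ ∈ C → Witness a B γ → ∃[ γ′ ] γ′ ∈ D × Witness a B γ′) where
  module ⟨C⟩ = Canonical T C
  module ⟨D⟩ = Canonical T D

  mutual
    transfer-Der : ∀ {p B} → ⟨C⟩.Der (a , p) B → InSig T B → ⟨D⟩.Der (a , p) B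
    transfer-Der (⟨C⟩.der-concept {A} m) A∈ with covers (atomic A) A∈ _ m refl
    ... | _ , m′ , refl = ⟨D⟩.der-concept m′
    transfer-Der (⟨C⟩.der-exists {R} {b = b} m) R∈ with covers (exists (role R)) R∈ _ m (b , refl)
    ... | _ , m′ , (_ , refl) = ⟨D⟩.der-exists m′
    transfer-Der (⟨C⟩.der-existsInv {R} {a = b} m) R∈ with covers (exists (inverse R)) R∈ _ m (b , refl)
    ... | _ , m′ , (_ , refl) = ⟨D⟩.der-existsInv m′
    transfer-Der ⟨C⟩.der-witness _ = ⟨D⟩.der-witness
    transfer-Der (⟨C⟩.der-conceptIncl ax d ds) _ =
      ⟨D⟩.der-conceptIncl ax (transfer-Der d (InSig-lhs ax)) (transfer-Ders ds (InSig-conj ax))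
    transfer-Der (⟨C⟩.der-roleIncl ax d) _ = ⟨D⟩.der-roleIncl ax (transfer-Der d (InSig-roleLhs ax))
    transfer-Der (⟨C⟩.der-roleInclInv {S = S} ax d) _ =
      ⟨D⟩.der-roleInclInv ax (transfer-Der d (subst (_∈ roleNames T) (sym (roleName-inv S)) (InSig-roleLhs ax)))

    transfer-Ders : ∀ {p Bs} → All (⟨C⟩.Der (a , p)) Bs → (∀ {B} → B ∈ Bs → InSig T B) →
                    All (⟨D⟩.Der (a , p)) Bs
    transfer-Ders [] _ = []
    transfer-Ders (d ∷ ds) sig = transfer-Der d (sig (here refl)) ∷ transfer-Ders ds (sig ∘ there)

  transfer-Reach : ∀ {p} → ⟨C⟩.Reach (a , p) → ⟨D⟩.Reach (a , p)
  transfer-Reach ⟨C⟩.reach-ind = ⟨D⟩.reach-ind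
  transfer-Reach (⟨C⟩.reach-succ r S∈ d) = ⟨D⟩.reach-succ (transfer-Reach r) S∈ (transfer-Der d S∈)

-- For an individual a, choose one witness in C for each basic concept of the
-- signature that has one: a sub-ABox of size ≤ |sigBasics T| that supports
-- every derivation about a.
module WitnessCore (em : EM) (T : TBox) (C : ABox) (a : ℕ) where

  private
    HasWitness : BasicConcept → Set
    HasWitness B = ∃[ γ ] γ ∈ C × Witness a B γ

    pick : (B : BasicConcept) → Dec (HasWitness B) → List Assertion
    pick B (yes (γ , _)) = γ ∷ []
    pick B (no _) = []

    picked : BasicConcept → List Assertion
    picked B = pick B (decide em (HasWitness B))

    pick-sound : ∀ B w {γ} → γ ∈ pick B w → γ ∈ C × Witness a B γ
    pick-sound B (yes (γ , γ∈ , wγ)) (here refl) = γ∈ , wγ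

    pick-length : ∀ B w → length (pick B w) ≤ 1
    pick-length B (yes _) = s≤s z≤n
    pick-length B (no _) = z≤n

    pick-complete : ∀ B → HasWitness B → ∀ w → ∃[ γ ] γ ∈ pick B w × Witness a B γ
    pick-complete B _ (yes (γ , _ , wγ)) = γ , here refl , wγ
    pick-complete B h (no ¬h) = ⊥-elim (¬h h)

  core : ABox
  core = concatMap picked (sigBasics T)

  core⊆ : core ⊆ C
  core⊆ γ∈ with concatMap-∈⁻ picked (sigBasics T) γ∈
  ... | B , _ , γ∈′ = proj₁ (pick-sound B (decide em (HasWitness B)) γ∈′)

  core-length : length core ≤ length (sigBasics T)
  core-length = length-concatMap-≤ picked (λ B → pick-length B (decide em (HasWitness B))) (sigBasics T)

  core-sig : All (InSigₐ T) core
  core-sig = All.tabulate λ {γ} γ∈ → sig γ γ∈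
    where
    sig : ∀ γ → γ ∈ core → InSigₐ T γ
    sig γ γ∈ with concatMap-∈⁻ picked (sigBasics T) γ∈
    ... | B , B∈ , γ∈′ = Witness-sig T a B γ (sigBasics→InSig T B B∈)
                                     (proj₂ (pick-sound B (decide em (HasWitness B)) γ∈′))

  covers : ∀ B → InSig T B → ∀ γ → γ ∈ C → Witness a B γ → ∃[ γ′ ] γ′ ∈ core × Witness a B γ′
  covers B B∈ γ γ∈ wγ with pick-complete B (γ , γ∈ , wγ) (decide em (HasWitness B))
  ... | γ′ , γ′∈ , wγ′ = γ′ , concatMap-∈⁺ picked (InSig→sigBasics T B B∈) γ′∈ , wγ′

  open Transfer T C core a covers public

coreBound : TBox → ℕ
coreBound T = length (sigBasics T) + 2

SmallCore : ∀ {ℓ} → TBox → ABox → (ABox → Set ℓ) → Set ℓ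
SmallCore T C P = ∃[ D ] D ⊆ C × length D ≤ coreBound T × All (InSigₐ T) D × P D

private
  link-assertion : ∀ T C {S a b} → Canonical.Link T C S (a , []) (b , []) → roleName S ∈ roleNames T →
    ∃[ γ ] γ ∈ C × InSigₐ T γ × (∀ D → γ ∈ D → Canonical.Link T D S (a , []) (b , []))
  link-assertion T C {a = a} {b} (Canonical.link-as {R} m s) S∈ =
    roleAs R a b , m , RoleSub-sig s S∈ , λ D m′ → Canonical.link-as m′ s
  link-assertion T C {a = a} {b} (Canonical.link-asInv {R} m s) S∈ =
    roleAs R b a , m , RoleSub-sig s S∈ , λ D m′ → Canonical.link-asInv m′ s

  role-clash-between-individuals : ∀ T C {S Q a b} → roleIncl S (negR Q) ∈ T →
    Canonical.Link T C S (a , []) (b , []) → Canonical.Link T C Q (a , []) (b , []) →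
    SmallCore T C (Canonical.Clash T)
  role-clash-between-individuals T C ax r q
    with link-assertion T C r (InSig-roleLhs ax) | link-assertion T C q (InSig-roleRhs ax)
  ... | γ₁ , γ₁∈ , sig₁ , r′ | γ₂ , γ₂∈ , sig₂ , q′ =
    γ₁ ∷ γ₂ ∷ [] , (λ { (here refl) → γ₁∈ ; (there (here refl)) → γ₂∈ }) ,
    ℕₚ.m≤n+m 2 (length (sigBasics T)) , sig₁ ∷ sig₂ ∷ [] ,
    Canonical.clash-role Canonical.reach-ind Canonical.reach-ind ax (r′ _ (here refl)) (q′ _ (there (here refl)))

  -- A clash is already a clash in a small sub-ABox: clashes at an anonymous or
  -- single individual need only the witnesses for that individual, a role
  -- clash between two individuals only the two role assertions.
  clash-local : EM → ∀ T C → Canonical.Clash T C → SmallCore T C (Canonical.Clash T)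
  clash-local em T C (Canonical.clash-concept {x = a , p} r ax d ds d′) =
    core , core⊆ , ℕₚ.≤-trans core-length (ℕₚ.m≤m+n _ 2) , core-sig ,
    Canonical.clash-concept (transfer-Reach r) ax (transfer-Der d (InSig-lhs ax))
      (transfer-Ders ds (InSig-conj ax)) (transfer-Der d′ (InSig-rhs ax))
    where open WitnessCore em T C a
  clash-local em T C (Canonical.clash-role rx ry ax r@(Canonical.link-as _ _) q) =
    role-clash-between-individuals T C ax r q
  clash-local em T C (Canonical.clash-role rx ry ax r@(Canonical.link-asInv _ _) q) =
    role-clash-between-individuals T C ax r q
  clash-local em T C (Canonical.clash-role {x = a , p} rx ry ax (Canonical.link-succ s₁) (Canonical.link-succ s₂)) =
    core , core⊆ , ℕₚ.≤-trans core-length (ℕₚ.m≤m+n _ 2) , core-sig ,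
    Canonical.clash-role (transfer-Reach rx) (transfer-Reach ry) ax (Canonical.link-succ s₁) (Canonical.link-succ s₂)
    where open WitnessCore em T C a
  clash-local em T C (Canonical.clash-role {y = a , p} rx ry ax (Canonical.link-pred s₁) (Canonical.link-pred s₂)) =
    core , core⊆ , ℕₚ.≤-trans core-length (ℕₚ.m≤m+n _ 2) , core-sig ,
    Canonical.clash-role (transfer-Reach rx) (transfer-Reach ry) ax (Canonical.link-pred s₁) (Canonical.link-pred s₂)
    where open WitnessCore em T C a

small-unsat-core : EM → ∀ T C → ¬ Satisfiable T C → SmallCore T C (λ D → ¬ Satisfiable T D)
small-unsat-core em T C unsat with decide em (Canonical.Clash T C)
... | no noClash = ⊥-elim (unsat (Canonical.canonical-model T C noClash))
... | yes clash with clash-local em T C clash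
...   | D , D⊆ , len , sig , clashD = D , D⊆ , len , sig , Canonical.clash-unsat T D clashD

Satisfiable-⊆ : ∀ {T C D} → D ⊆ C → Satisfiable T C → Satisfiable T D
Satisfiable-⊆ D⊆C (I , satT , satC) = I , satT , All.tabulate (All.lookup satC ∘ D⊆C)

rename : (ℕ → ℕ) → Assertion → Assertion
rename f (conceptAs A a) = conceptAs A (f a)
rename f (roleAs R a b) = roleAs R (f a) (f b)

individuals : Assertion → List ℕ
individuals (conceptAs A a) = a ∷ []
individuals (roleAs R a b) = a ∷ b ∷ []

individualsₗ : List Assertion → List ℕ
individualsₗ = concatMap individuals

InjectiveOn : (ℕ → ℕ) → List ℕ → Set
InjectiveOn f xs = ∀ {u v} → u ∈ xs → v ∈ xs → f u ≡ f v → u ≡ v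

rename-cong : ∀ f g γ → (∀ u → u ∈ individuals γ → f u ≡ g u) → rename f γ ≡ rename g γ
rename-cong f g (conceptAs A a) f≗g = cong (conceptAs A) (f≗g a (here refl))
rename-cong f g (roleAs R a b) f≗g = cong₂ (roleAs R) (f≗g a (here refl)) (f≗g b (there (here refl)))

rename-∘ : ∀ f g γ → rename f (rename g γ) ≡ rename (f ∘ g) γ
rename-∘ f g (conceptAs A a) = refl
rename-∘ f g (roleAs R a b) = refl

rename-id : ∀ γ → rename (λ x → x) γ ≡ γ
rename-id (conceptAs A a) = refl
rename-id (roleAs R a b) = refl

rename-InSig : ∀ T f γ → InSigₐ T γ → InSigₐ T (rename f γ)
rename-InSig T f (conceptAs A a) A∈ = A∈
rename-InSig T f (roleAs R a b) R∈ = R∈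

individuals-rename⁻ : ∀ f γ {u} → u ∈ individuals (rename f γ) → ∃[ v ] v ∈ individuals γ × u ≡ f v
individuals-rename⁻ f (conceptAs A a) (here refl) = a , here refl , refl
individuals-rename⁻ f (roleAs R a b) (here refl) = a , here refl , refl
individuals-rename⁻ f (roleAs R a b) (there (here refl)) = b , there (here refl) , refl

individuals-rename⁺ : ∀ f γ {v} → v ∈ individuals γ → f v ∈ individuals (rename f γ)
individuals-rename⁺ f (conceptAs A a) (here refl) = here refl
individuals-rename⁺ f (roleAs R a b) (here refl) = here refl
individuals-rename⁺ f (roleAs R a b) (there (here refl)) = there (here refl)

individualsₗ-∈⁺ : ∀ {γ C u} → γ ∈ C → u ∈ individuals γ → u ∈ individualsₗ C
individualsₗ-∈⁺ = concatMap-∈⁺ individuals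

individualsₗ-∈⁻ : ∀ C {u} → u ∈ individualsₗ C → ∃[ γ ] γ ∈ C × u ∈ individuals γ
individualsₗ-∈⁻ = concatMap-∈⁻ individuals

individualsₗ-⊆ : ∀ {C D} → C ⊆ D → individualsₗ C ⊆ individualsₗ D
individualsₗ-⊆ {C} C⊆D u∈ with individualsₗ-∈⁻ C u∈
... | γ , γ∈ , u∈γ = individualsₗ-∈⁺ (C⊆D γ∈) u∈γ

individualsₗ-length : ∀ C → length (individualsₗ C) ≤ 2 * length C
individualsₗ-length [] = z≤n
individualsₗ-length (γ ∷ C) = ℕₚ.≤-trans (ℕₚ.≤-reflexive (Listₚ.length-++ (individuals γ)))
  (ℕₚ.≤-trans (ℕₚ.+-mono-≤ (at-most-two γ) (individualsₗ-length C))
              (ℕₚ.≤-reflexive (sym (ℕₚ.*-suc 2 (length C)))))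
  where
  at-most-two : ∀ γ → length (individuals γ) ≤ 2
  at-most-two (conceptAs _ _) = s≤s z≤n
  at-most-two (roleAs _ _ _) = s≤s (s≤s z≤n)

-- Reinterpreting the individual names of an interpretation.  TBox axioms do
-- not mention individuals, so their satisfaction is unaffected.
withIndividuals : (I : Interp) → (ℕ → Interp.Δ I) → Interp
withIndividuals I g = record { Δ = Interp.Δ I ; indI = g ; conI = Interp.conI I ; roleI = Interp.roleI I }

module _ (I : Interp) (g : ℕ → Interp.Δ I) where
  private
    I′ : Interp
    I′ = withIndividuals I g

    ⟦S⟧⁻ : ∀ S {x y} → ⟦_⟧S I′ S x y → ⟦_⟧S I S x y
    ⟦S⟧⁻ (role R) r = r
    ⟦S⟧⁻ (inverse R) r = r

    ⟦S⟧⁺ : ∀ S {x y} → ⟦_⟧S I S x y → ⟦_⟧S I′ S x y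
    ⟦S⟧⁺ (role R) r = r
    ⟦S⟧⁺ (inverse R) r = r

    ⟦B⟧⁻ : ∀ B {x} → ⟦_⟧B I′ B x → ⟦_⟧B I B x
    ⟦B⟧⁻ (atomic A) b = b
    ⟦B⟧⁻ (exists S) (y , r) = y , ⟦S⟧⁻ S r

    ⟦B⟧⁺ : ∀ B {x} → ⟦_⟧B I B x → ⟦_⟧B I′ B x
    ⟦B⟧⁺ (atomic A) b = b
    ⟦B⟧⁺ (exists S) (y , r) = y , ⟦S⟧⁺ S r

    ⟦C⟧⁺ : ∀ C {x} → ⟦_⟧C I C x → ⟦_⟧C I′ C x
    ⟦C⟧⁺ (posC B) b = ⟦B⟧⁺ B b
    ⟦C⟧⁺ (negC B) ¬b b = ¬b (⟦B⟧⁻ B b)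

    ⟦Q⟧⁺ : ∀ Q {x y} → ⟦_⟧Q I Q x y → ⟦_⟧Q I′ Q x y
    ⟦Q⟧⁺ (posR S) r = ⟦S⟧⁺ S r
    ⟦Q⟧⁺ (negR S) ¬r r = ¬r (⟦S⟧⁻ S r)

    SatAxiom-withIndividuals : ∀ ax → SatAxiom I ax → SatAxiom I′ ax
    SatAxiom-withIndividuals (conceptIncl B Bs C) sat x b bs =
      ⟦C⟧⁺ C (sat x (⟦B⟧⁻ B b) (All.map (λ {B′} → ⟦B⟧⁻ B′) bs))
    SatAxiom-withIndividuals (roleIncl S Q) sat x y r = ⟦Q⟧⁺ Q (sat x y (⟦S⟧⁻ S r))

  TBox-withIndividuals : ∀ {T} → All (SatAxiom I) T → All (SatAxiom (withIndividuals I g)) T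
  TBox-withIndividuals = All.map (λ {ax} → SatAxiom-withIndividuals ax)

Satisfiable-rename⁻ : ∀ T f C → Satisfiable T (map (rename f) C) → Satisfiable T C
Satisfiable-rename⁻ T f C (I , satT , satC) =
  withIndividuals I (indI ∘ f) , TBox-withIndividuals I (indI ∘ f) satT ,
  All.map (λ {γ} → back γ) (Allₚ.map⁻ satC)
  where
  open Interp I
  back : ∀ γ → SatAssertion I (rename f γ) → SatAssertion (withIndividuals I (indI ∘ f)) γ
  back (conceptAs A a) s = s
  back (roleAs R a b) s = s

leftInverse : (ℕ → ℕ) → List ℕ → ℕ → ℕ
leftInverse f [] n = 0
leftInverse f (u ∷ us) n with f u ≟ n
... | yes _ = u
... | no _ = leftInverse f us n

leftInverse-correct : ∀ f us → InjectiveOn f us → ∀ {u} → u ∈ us → leftInverse f us (f u) ≡ u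
leftInverse-correct f (u′ ∷ us) inj {u} u∈ with f u′ ≟ f u
... | yes eq = inj (here refl) u∈ eq
leftInverse-correct f (u′ ∷ us) inj (here refl) | no ne = ⊥-elim (ne refl)
leftInverse-correct f (u′ ∷ us) inj (there u∈) | no _ =
  leftInverse-correct f us (λ p q → inj (there p) (there q)) u∈

Satisfiable-rename⁺ : ∀ T f C → InjectiveOn f (individualsₗ C) → Satisfiable T C → Satisfiable T (map (rename f) C)
Satisfiable-rename⁺ T f C inj (I , satT , satC) =
  I′ , TBox-withIndividuals I (indI ∘ g) satT ,
  Allₚ.map⁺ (All.tabulate λ {γ} γ∈ → forth γ γ∈ (All.lookup satC γ∈))
  where
  open Interp I
  g : ℕ → ℕ
  g = leftInverse f (individualsₗ C)
  I′ : Interp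
  I′ = withIndividuals I (indI ∘ g)
  g∘f : ∀ {γ u} → γ ∈ C → u ∈ individuals γ → u ≡ g (f u)
  g∘f γ∈ u∈ = sym (leftInverse-correct f (individualsₗ C) inj (individualsₗ-∈⁺ γ∈ u∈))
  forth : ∀ γ → γ ∈ C → SatAssertion I γ → SatAssertion I′ (rename f γ)
  forth (conceptAs A a) γ∈ s = subst (λ z → conI A (indI z)) (g∘f γ∈ (here refl)) s
  forth (roleAs R a b) γ∈ s =
    subst₂ (λ z z′ → roleI R (indI z) (indI z′)) (g∘f γ∈ (here refl)) (g∘f γ∈ (there (here refl))) s

-- C is a minimal unsatisfiable ABox; IsConflict T A C is C ⊆ A × MinimalUnsat T C.
MinimalUnsat : TBox → ABox → Set₁
MinimalUnsat T C = ¬ Satisfiable T C × (∀ C′ → C′ ⊆ C → ¬ Satisfiable T C′ → C ⊆ C′)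

-- Minimal unsatisfiability is preserved by injective renamings of individuals:
-- an unsatisfiable C′ ⊆ f(C) has an unsatisfiable preimage in C.
MinimalUnsat-rename : ∀ T f C → InjectiveOn f (individualsₗ C) → MinimalUnsat T C → MinimalUnsat T (map (rename f) C)
MinimalUnsat-rename T f C inj (unsat , minimal) = unsat ∘ Satisfiable-rename⁻ T f C , minimal′
  where
  minimal′ : ∀ C′ → C′ ⊆ map (rename f) C → ¬ Satisfiable T C′ → map (rename f) C ⊆ C′
  minimal′ C′ C′⊆ unsat′ =
    preimage→C′ ∘ Subsetₚ.map⁺ (rename f) (minimal preimage preimage⊆C unsat-preimage)
    where
    maps-into? : Decidable (λ γ → rename f γ ∈ C′)
    maps-into? γ = member? _≟ₐ_ (rename f γ) C′
    preimage : ABox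
    preimage = filter maps-into? C
    preimage⊆C : preimage ⊆ C
    preimage⊆C = proj₁ ∘ ∈-filter⁻ maps-into? {xs = C}
    preimage→C′ : map (rename f) preimage ⊆ C′
    preimage→C′ δ∈ with ∈-map⁻ (rename f) δ∈
    ... | γ , γ∈ , refl = proj₂ (∈-filter⁻ maps-into? {xs = C} γ∈)
    C′→preimage : C′ ⊆ map (rename f) preimage
    C′→preimage δ∈ with ∈-map⁻ (rename f) (C′⊆ δ∈)
    ... | γ , γ∈ , refl = ∈-map⁺ (rename f) (∈-filter⁺ maps-into? γ∈ δ∈)
    unsat-preimage : ¬ Satisfiable T preimage
    unsat-preimage sat = unsat′ (Satisfiable-⊆ C′→preimage
      (Satisfiable-rename⁺ T f preimage
        (λ p q → inj (individualsₗ-⊆ preimage⊆C p) (individualsₗ-⊆ preimage⊆C q)) sat))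

MinimalUnsat-≐ : ∀ T {C D} → C ⊆ D → D ⊆ C → MinimalUnsat T C → MinimalUnsat T D
MinimalUnsat-≐ T C⊆D D⊆C (unsat , minimal) =
  unsat ∘ Satisfiable-⊆ C⊆D , λ C′ C′⊆ unsat′ → minimal C′ (D⊆C ∘ C′⊆) unsat′ ∘ D⊆C

-- Conflict shapes: minimal unsatisfiable ABoxes of bounded size over T's
-- signature with individuals below a fixed bound.  There are finitely many,
-- and every conflict is an injective renaming of one of them.
module Shapes (em : EM) (T : TBox) where

  shapeSize : ℕ
  shapeSize = coreBound T

  individualBound : ℕ
  individualBound = 2 * shapeSize

  InAlphabet : Assertion → Set
  InAlphabet γ = InSigₐ T γ × All (_< individualBound) (individuals γ)

  private
    conceptAssertions roleAssertions : List Assertion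
    conceptAssertions = concatMap (λ A → map (conceptAs A) (downFrom individualBound)) (conceptNames T)
    roleAssertions = concatMap (λ R → concatMap (λ a → map (roleAs R a) (downFrom individualBound))
                                                (downFrom individualBound)) (roleNames T)

  alphabet : List Assertion
  alphabet = conceptAssertions ++ roleAssertions

  alphabet-∈⁺ : ∀ γ → InAlphabet γ → γ ∈ alphabet
  alphabet-∈⁺ (conceptAs A a) (A∈ , a< ∷ []) =
    ∈-++⁺ˡ (concatMap-∈⁺ _ A∈ (∈-map⁺ (conceptAs A) (∈-downFrom⁺ a<)))
  alphabet-∈⁺ (roleAs R a b) (R∈ , a< ∷ b< ∷ []) =
    ∈-++⁺ʳ conceptAssertions
      (concatMap-∈⁺ _ R∈ (concatMap-∈⁺ _ (∈-downFrom⁺ a<) (∈-map⁺ (roleAs R a) (∈-downFrom⁺ b<))))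

  alphabet-∈⁻ : ∀ γ → γ ∈ alphabet → InAlphabet γ
  alphabet-∈⁻ γ γ∈ with ∈-++⁻ conceptAssertions γ∈
  ... | inj₁ γ∈′ with concatMap-∈⁻ _ (conceptNames T) γ∈′
  ...   | A , A∈ , γ∈″ with ∈-map⁻ (conceptAs A) γ∈″
  ...     | a , a∈ , refl = A∈ , ∈-downFrom⁻ a∈ ∷ []
  alphabet-∈⁻ γ γ∈ | inj₂ γ∈′ with concatMap-∈⁻ _ (roleNames T) γ∈′
  ... | R , R∈ , γ∈″ with concatMap-∈⁻ _ (downFrom individualBound) γ∈″
  ...   | a , a∈ , γ∈‴ with ∈-map⁻ (roleAs R a) γ∈‴
  ...     | b , b∈ , refl = R∈ , ∈-downFrom⁻ a∈ ∷ ∈-downFrom⁻ b∈ ∷ []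

  IsShape : List Assertion → Set₁
  IsShape s = MinimalUnsat T s × All InAlphabet s × length s ≤ shapeSize

  opaque
    shapes : List (List Assertion)
    shapes = filter (λ s → em {MinimalUnsat T s}) (listsUpTo shapeSize alphabet)

    shapes-∈⁻ : ∀ {s} → s ∈ shapes → IsShape s
    shapes-∈⁻ {s} s∈ with ∈-filter⁻ (λ s → em {MinimalUnsat T s}) {xs = listsUpTo shapeSize alphabet} s∈
    ... | s∈′ , minimal with listsUpTo-∈⁻ alphabet shapeSize s s∈′
    ...   | s⊆ , len = minimal , All.map (λ {γ} → alphabet-∈⁻ γ) s⊆ , len

    shapes-∈⁺ : ∀ s → IsShape s → s ∈ shapes
    shapes-∈⁺ s (minimal , inAlph , len) = ∈-filter⁺ (λ s → em {MinimalUnsat T s})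
      (listsUpTo-∈⁺ alphabet shapeSize s (All.map (λ {γ} → alphabet-∈⁺ γ) inAlph) len) minimal

  -- C is, up to duplicates, the image of a shape under an injective renaming g.
  record Instance (C : ABox) : Set₁ where
    field
      C′ : List Assertion
      C′⊆C : C′ ⊆ C
      C⊆C′ : C ⊆ C′
      unique : Unique C′
      shape : List Assertion
      shape∈ : shape ∈ shapes
      g : ℕ → ℕ
      g-shape : map (rename g) shape ≡ C′
      g-injective : InjectiveOn g (individualsₗ shape)

  private
    duplicate-free-core : ∀ C → MinimalUnsat T C →
      ∃[ C′ ] C′ ⊆ C × C ⊆ C′ × Unique C′ × length C′ ≤ shapeSize ×
              All (InSigₐ T) C′ × MinimalUnsat T C′
    duplicate-free-core C minimal@(unsat , min)
      with small-unsat-core em T C unsat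
    ... | D , D⊆C , lenD , sigD , unsatD =
      C′ , D⊆C ∘ ∈-deduplicate⁻ _≟ₐ_ D , ∈-deduplicate⁺ _≟ₐ_ ∘ C⊆D , deduplicate-! _≟ₐ_ D ,
      ℕₚ.≤-trans (Listₚ.length-deduplicate _≟ₐ_ D) lenD ,
      All.tabulate (All.lookup sigD ∘ ∈-deduplicate⁻ _≟ₐ_ D) ,
      MinimalUnsat-≐ T (∈-deduplicate⁺ _≟ₐ_ ∘ C⊆D) (D⊆C ∘ ∈-deduplicate⁻ _≟ₐ_ D) minimal
      where
      C′ : ABox
      C′ = deduplicate _≟ₐ_ D
      C⊆D : C ⊆ D
      C⊆D = min D D⊆C unsatD

    -- Renumbering the individuals of such an ABox by their position in the list
    -- of its individuals yields a shape.
    module Normalise (C′ : List Assertion) (lenC′ : length C′ ≤ shapeSize) (sigC′ : All (InSigₐ T) C′)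
                     (minimalC′ : MinimalUnsat T C′) where
      names : List ℕ
      names = deduplicate _≟_ (individualsₗ C′)

      idx g : ℕ → ℕ
      idx = indexOf names
      g = nth 0 names

      idx-correct : ∀ {a} → a ∈ individualsₗ C′ → idx a < length names × g (idx a) ≡ a
      idx-correct a∈ = indexOf-correct names (∈-deduplicate⁺ _≟_ a∈)

      names-bound : length names ≤ individualBound
      names-bound = ℕₚ.≤-trans (Listₚ.length-deduplicate _≟_ (individualsₗ C′))
        (ℕₚ.≤-trans (individualsₗ-length C′) (ℕₚ.*-monoʳ-≤ 2 lenC′))

      shape : List Assertion
      shape = map (rename idx) C′

      shape-individuals : ∀ {u} → u ∈ individualsₗ shape → ∃[ a ] a ∈ individualsₗ C′ × u ≡ idx a
      shape-individuals u∈ with individualsₗ-∈⁻ shape u∈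
      ... | δ , δ∈ , u∈δ with ∈-map⁻ (rename idx) δ∈
      ...   | γ , γ∈ , refl with individuals-rename⁻ idx γ u∈δ
      ...     | a , a∈ , refl = a , individualsₗ-∈⁺ γ∈ a∈ , refl

      shape-individual-bound : ∀ {u} → u ∈ individualsₗ shape → u < length names
      shape-individual-bound u∈ with shape-individuals u∈
      ... | a , a∈ , refl = proj₁ (idx-correct a∈)

      idx-injective : InjectiveOn idx (individualsₗ C′)
      idx-injective a∈ b∈ eq =
        trans (sym (proj₂ (idx-correct a∈))) (trans (cong g eq) (proj₂ (idx-correct b∈)))

      g-injective : InjectiveOn g (individualsₗ shape)
      g-injective u∈ v∈ = nth-injective 0 names (deduplicate-! _≟_ (individualsₗ C′))
        (shape-individual-bound u∈) (shape-individual-bound v∈)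

      g-shape : map (rename g) shape ≡ C′
      g-shape = trans (sym (Listₚ.map-∘ C′)) (Listₚ.map-id-local (All.tabulate λ {γ} γ∈ →
        trans (rename-∘ g idx γ) (trans (rename-cong (g ∘ idx) (λ x → x) γ
          (λ u u∈ → proj₂ (idx-correct (individualsₗ-∈⁺ γ∈ u∈)))) (rename-id γ))))

      shape-in-alphabet : All InAlphabet shape
      shape-in-alphabet = Allₚ.map⁺ (All.tabulate λ {γ} γ∈ →
        rename-InSig T idx γ (All.lookup sigC′ γ∈) ,
        All.tabulate (λ u∈ → ℕₚ.<-≤-trans
          (shape-individual-bound (individualsₗ-∈⁺ (∈-map⁺ (rename idx) γ∈) u∈)) names-bound))

      shape∈ : shape ∈ shapes
      shape∈ = shapes-∈⁺ shape
        ( MinimalUnsat-rename T idx C′ idx-injective minimalC′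
        , shape-in-alphabet
        , ℕₚ.≤-trans (ℕₚ.≤-reflexive (Listₚ.length-map (rename idx) C′)) lenC′ )

  instanceOf : ∀ C → MinimalUnsat T C → Instance C
  instanceOf C minimal with duplicate-free-core C minimal
  ... | C′ , C′⊆C , C⊆C′ , unique , lenC′ , sigC′ , minimalC′ = record
    { C′ = C′ ; C′⊆C = C′⊆C ; C⊆C′ = C⊆C′ ; unique = unique
    ; shape = N.shape ; shape∈ = N.shape∈ ; g = N.g ; g-shape = N.g-shape ; g-injective = N.g-injective }
    where module N = Normalise C′ lenC′ sigC′ minimalC′

defeatedP attackedP eqP : Pred
defeatedP = auxP 0
attackedP = auxP 1
eqP = auxP 2

VarAtom : Set
VarAtom = Pred × List ℕ

vatom : VarAtom → Atom
vatom (p , xs) = atom p (map var xs)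

ground : (ℕ → Const) → VarAtom → GAtom
ground σ (p , xs) = gatom p (map σ xs)

ground-vatom : ∀ σ x → groundAtom σ (vatom x) ≡ ground σ x
ground-vatom σ (p , xs) = cong (gatom p) (sym (Listₚ.map-∘ xs))

schema : VarAtom → List VarAtom → List VarAtom → Rule
schema h ps ns = rule (vatom h) (map vatom ps) (map vatom ns)

private
  schema-atom : ∀ {h ps ns a} → a ∈ vatom h ∷ map vatom ps ++ map vatom ns → ∃[ x ] a ≡ vatom x
  schema-atom (here refl) = _ , refl
  schema-atom {ps = ps} (there a∈) with ∈-++⁻ (map vatom ps) a∈
  ... | inj₁ a∈ps with ∈-map⁻ vatom a∈ps
  ...   | x , _ , eq = x , eq
  schema-atom (there a∈) | inj₂ a∈ns with ∈-map⁻ vatom a∈ns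
  ...   | x , _ , eq = x , eq

schema-closed : ∀ h ps ns {c} → c ∈ ruleConsts (schema h ps ns) → ⊥
schema-closed h ps ns c∈ with concatMap-∈⁻ atomConsts (vatom h ∷ map vatom ps ++ map vatom ns) c∈
... | a , a∈ , c∈a with schema-atom {h} {ps} {ns} a∈
...   | (p , xs) , refl with concatMap-∈⁻ termConsts (map var xs) c∈a
...     | t , t∈ , c∈t with ∈-map⁻ var t∈
...       | v , _ , refl with c∈t
...         | ()

schema-groundConst : ∀ σ h ps ns {c} → c ∈ groundRuleConsts σ (schema h ps ns) → ∃[ v ] c ≡ σ v
schema-groundConst σ h ps ns c∈ with concatMap-∈⁻ (groundAtomConsts σ) (vatom h ∷ map vatom ps ++ map vatom ns) c∈
... | a , a∈ , c∈a with schema-atom {h} {ps} {ns} a∈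
...   | (p , xs) , refl with ∈-map⁻ (groundTerm σ) c∈a
...     | t , t∈ , refl with ∈-map⁻ var t∈
...       | v , _ , refl = v , refl

-- The program Π_T.  For a shape s, variable v < individualBound stands for an
-- individual and idVar k for the identifier of the k-th assertion of s.
module Program (em : EM) (T : TBox) where
  open Shapes em T public

  idVar : ℕ → ℕ
  idVar k = individualBound + k

  anyAssertion : Assertion
  anyAssertion = conceptAs 0 0

  assertionPattern : ℕ → Assertion → VarAtom
  assertionPattern k (conceptAs A v) = conceptP A , v ∷ idVar k ∷ []
  assertionPattern k (roleAs R v w) = roleP R , v ∷ w ∷ idVar k ∷ []

  patterns : List Assertion → List VarAtom
  patterns s = map (λ k → assertionPattern k (nth anyAssertion s k)) (upTo (length s))

  -- eq(u, v) for distinct individual variables u, v of s (used negatively, so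
  -- that the individuals of s are matched injectively).
  distinct : List Assertion → List VarAtom
  distinct s = map (λ (u , v) → eqP , u ∷ v ∷ [])
    (filter (λ (u , v) → ¬? (u ≟ v)) (cartesianProduct (individualsₗ s) (individualsₗ s)))

  others : ℕ → List Assertion → List ℕ
  others i s = filter (λ k → ¬? (k ≟ i)) (upTo (length s))

  preferredOver attackersAttacked attackersAccepted : ℕ → List Assertion → List VarAtom
  preferredOver i s = map (λ k → pref , idVar i ∷ idVar k ∷ []) (others i s)
  attackersAttacked i s = map (λ k → attackedP , idVar k ∷ []) (others i s)
  attackersAccepted i s = map (λ k → acc , idVar k ∷ []) (others i s)

  defeatRule attackRule : List Assertion → ℕ → Rule
  defeatRule s i = schema (defeatedP , idVar i ∷ []) (patterns s)
                          (distinct s ++ preferredOver i s ++ attackersAttacked i s)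
  attackRule s i = schema (attackedP , idVar i ∷ []) (patterns s ++ attackersAccepted i s)
                          (distinct s ++ preferredOver i s)

  acceptRule equalityRule : Rule
  acceptRule = schema (acc , 0 ∷ []) [] ((defeatedP , 0 ∷ []) ∷ [])
  equalityRule = schema (eqP , 0 ∷ 0 ∷ []) [] []

  shapeRules : List Assertion → List Rule
  shapeRules s = concatMap (λ i → defeatRule s i ∷ attackRule s i ∷ []) (upTo (length s))

  data RuleView : Rule → Set where
    view-accept : RuleView acceptRule
    view-equality : RuleView equalityRule
    view-defeat : ∀ s i → s ∈ shapes → i < length s → RuleView (defeatRule s i)
    view-attack : ∀ s i → s ∈ shapes → i < length s → RuleView (attackRule s i)

  opaque
    ΠT : List Rule
    ΠT = acceptRule ∷ equalityRule ∷ concatMap shapeRules shapes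

    view : ∀ {r} → r ∈ ΠT → RuleView r
    view (here refl) = view-accept
    view (there (here refl)) = view-equality
    view (there (there r∈)) with concatMap-∈⁻ shapeRules shapes r∈
    ... | s , s∈ , r∈′ with concatMap-∈⁻ (λ i → defeatRule s i ∷ attackRule s i ∷ []) (upTo (length s)) r∈′
    ...   | i , i∈ , here refl = view-defeat s i s∈ (∈-upTo⁻ i∈)
    ...   | i , i∈ , there (here refl) = view-attack s i s∈ (∈-upTo⁻ i∈)

    accept∈ : acceptRule ∈ ΠT
    accept∈ = here refl

    equality∈ : equalityRule ∈ ΠT
    equality∈ = there (here refl)

    defeat∈ : ∀ {s i} → s ∈ shapes → i < length s → defeatRule s i ∈ ΠT
    defeat∈ s∈ i< = there (there (concatMap-∈⁺ shapeRules s∈ (concatMap-∈⁺ _ (∈-upTo⁺ i<) (here refl))))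

    attack∈ : ∀ {s i} → s ∈ shapes → i < length s → attackRule s i ∈ ΠT
    attack∈ s∈ i< =
      there (there (concatMap-∈⁺ shapeRules s∈ (concatMap-∈⁺ _ (∈-upTo⁺ i<) (there (here refl)))))

  -- Π_T mentions no constants, so every identifier constant of the full
  -- program stems from A_id or from the preference facts.
  ΠT-closed : ∀ {r c} → r ∈ ΠT → c ∈ ruleConsts r → ⊥
  ΠT-closed r∈ with view r∈
  ... | view-accept = schema-closed (acc , 0 ∷ []) [] ((defeatedP , 0 ∷ []) ∷ [])
  ... | view-equality = schema-closed (eqP , 0 ∷ 0 ∷ []) [] []
  ... | view-defeat s i _ _ = schema-closed (defeatedP , idVar i ∷ []) (patterns s)
                                            (distinct s ++ preferredOver i s ++ attackersAttacked i s)
  ... | view-attack s i _ _ = schema-closed (attackedP , idVar i ∷ []) (patterns s ++ attackersAccepted i s)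
                                            (distinct s ++ preferredOver i s)

  patterns-∈⁺ : ∀ s {k} → k < length s → assertionPattern k (nth anyAssertion s k) ∈ patterns s
  patterns-∈⁺ s k< = ∈-map⁺ (λ k → assertionPattern k (nth anyAssertion s k)) (∈-upTo⁺ k<)

  patterns-∈⁻ : ∀ s {x} → x ∈ patterns s → ∃[ k ] k < length s × x ≡ assertionPattern k (nth anyAssertion s k)
  patterns-∈⁻ s x∈ with ∈-map⁻ (λ k → assertionPattern k (nth anyAssertion s k)) x∈
  ... | k , k∈ , refl = k , ∈-upTo⁻ k∈ , refl

  distinct-∈⁺ : ∀ s {u v} → u ∈ individualsₗ s → v ∈ individualsₗ s → u ≢ v →
                (eqP , u ∷ v ∷ []) ∈ distinct s
  distinct-∈⁺ s u∈ v∈ u≢v =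
    ∈-map⁺ _ (∈-filter⁺ (λ (u , v) → ¬? (u ≟ v)) (∈-cartesianProduct⁺ u∈ v∈) u≢v)

  distinct-∈⁻ : ∀ s {x} → x ∈ distinct s →
    ∃[ u ] ∃[ v ] u ∈ individualsₗ s × v ∈ individualsₗ s × u ≢ v × x ≡ (eqP , u ∷ v ∷ [])
  distinct-∈⁻ s x∈ with ∈-map⁻ _ x∈
  ... | (u , v) , uv∈ , refl
    with ∈-filter⁻ (λ (u , v) → ¬? (u ≟ v)) {xs = cartesianProduct (individualsₗ s) (individualsₗ s)} uv∈
  ...   | uv∈′ , u≢v with ∈-cartesianProduct⁻ (individualsₗ s) (individualsₗ s) uv∈′
  ...     | u∈ , v∈ = u , v , u∈ , v∈ , u≢v , refl

  others-∈⁺ : ∀ i s {k} → k < length s → k ≢ i → k ∈ others i s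
  others-∈⁺ i s k< k≢i = ∈-filter⁺ (λ k → ¬? (k ≟ i)) (∈-upTo⁺ k<) k≢i

  others-∈⁻ : ∀ i s {k} → k ∈ others i s → k < length s × k ≢ i
  others-∈⁻ i s k∈ with ∈-filter⁻ (λ k → ¬? (k ≟ i)) {xs = upTo (length s)} k∈
  ... | k∈′ , k≢i = ∈-upTo⁻ k∈′ , k≢i

Body : Program → (GAtom → Set) → (ℕ → Const) → List VarAtom → List VarAtom → Set
Body Π I σ ps ns = (∀ x → x ∈ ps → MinModel Π I (ground σ x)) × (∀ x → x ∈ ns → ¬ I (ground σ x))

module _ {Π : Program} {I : GAtom → Set} where

  fire : ∀ {h ps ns} σ → Π (schema h ps ns) → (∀ v → ProgConst Π (σ v)) → Body Π I σ ps ns →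
         MinModel Π I (ground σ h)
  fire {h} {ps} {ns} σ r∈ σ-const (pos , neg) =
    derive (schema h ps ns) σ _ r∈ consts negs poss (ground-vatom σ h)
    where
    consts : ∀ c → c ∈ groundRuleConsts σ (schema h ps ns) → ProgConst Π c
    consts c c∈ with schema-groundConst σ h ps ns c∈
    ... | v , refl = σ-const v
    negs : ∀ b → b ∈ map vatom ns → ¬ I (groundAtom σ b)
    negs b b∈ with ∈-map⁻ vatom b∈
    ... | x , x∈ , refl = neg x x∈ ∘ subst I (ground-vatom σ x)
    poss : ∀ b → b ∈ map vatom ps → MinModel Π I (groundAtom σ b)
    poss b b∈ with ∈-map⁻ vatom b∈
    ... | x , x∈ , refl = subst (MinModel Π I) (sym (ground-vatom σ x)) (pos x x∈)

  unfire : ∀ {ps ns} σ → (∀ b → b ∈ map vatom ns → ¬ I (groundAtom σ b)) →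
           (∀ b → b ∈ map vatom ps → MinModel Π I (groundAtom σ b)) → Body Π I σ ps ns
  unfire σ negs poss =
    (λ x x∈ → subst (MinModel Π I) (ground-vatom σ x) (poss (vatom x) (∈-map⁺ vatom x∈))) ,
    (λ x x∈ → negs (vatom x) (∈-map⁺ vatom x∈) ∘ subst I (sym (ground-vatom σ x)))

module Semantics (em : EM) (T : TBox) (A : ABox) (_≻_ : Assertion → Assertion → Set)
                 (priority : IsPriority T A _≻_) where
  open Program em T public

  Π : Program
  Π = FullProgram ΠT A _≻_

  PC : Const → Set
  PC = ProgConst Π

  idGAtom : Assertion → GAtom
  idGAtom γ@(conceptAs A′ a) = gatom (conceptP A′) (ind a ∷ ident γ ∷ [])
  idGAtom γ@(roleAs R a b) = gatom (roleP R) (ind a ∷ ind b ∷ ident γ ∷ [])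

  PC-ident : ∀ {γ} → γ ∈ A → PC (ident γ)
  PC-ident {conceptAs _ _} γ∈ = _ , inj₂ (inj₁ (_ , γ∈ , refl)) , there (here refl)
  PC-ident {roleAs _ _ _} γ∈ = _ , inj₂ (inj₁ (_ , γ∈ , refl)) , there (there (here refl))

  PC-ind : ∀ {γ u} → γ ∈ A → u ∈ individuals γ → PC (ind u)
  PC-ind {conceptAs _ _} γ∈ (here refl) = _ , inj₂ (inj₁ (_ , γ∈ , refl)) , here refl
  PC-ind {roleAs _ _ _} γ∈ (here refl) = _ , inj₂ (inj₁ (_ , γ∈ , refl)) , here refl
  PC-ind {roleAs _ _ _} γ∈ (there (here refl)) = _ , inj₂ (inj₁ (_ , γ∈ , refl)) , there (here refl)

  PC-ident⁻ : ∀ {α} → PC (ident α) → α ∈ A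
  PC-ident⁻ (_ , inj₁ r∈ , c∈) = ⊥-elim (ΠT-closed r∈ c∈)
  PC-ident⁻ (_ , inj₂ (inj₁ (conceptAs _ _ , γ∈ , refl)) , there (here refl)) = γ∈
  PC-ident⁻ (_ , inj₂ (inj₁ (roleAs _ _ _ , γ∈ , refl)) , there (there (here refl))) = γ∈
  PC-ident⁻ (_ , inj₂ (inj₂ (α , β , α≻β , refl)) , here refl) with proj₂ priority α β α≻β
  ... | _ , (C⊆A , _) , α∈ , _ = C⊆A α∈
  PC-ident⁻ (_ , inj₂ (inj₂ (α , β , α≻β , refl)) , there (here refl)) with proj₂ priority α β α≻β
  ... | _ , (C⊆A , _) , _ , β∈ = C⊆A β∈

  module _ {I : GAtom → Set} where

    fact-derived : ∀ {γ} → γ ∈ A → MinModel Π I (idGAtom γ)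
    fact-derived {conceptAs _ _} γ∈ =
      derive _ (λ _ → ind 0) _ (inj₂ (inj₁ (_ , γ∈ , refl)))
             (λ c c∈ → _ , inj₂ (inj₁ (_ , γ∈ , refl)) , c∈)
             (λ _ ()) (λ _ ()) refl
    fact-derived {roleAs _ _ _} γ∈ =
      derive _ (λ _ → ind 0) _ (inj₂ (inj₁ (_ , γ∈ , refl)))
             (λ c c∈ → _ , inj₂ (inj₁ (_ , γ∈ , refl)) , c∈)
             (λ _ ()) (λ _ ()) refl

    pref-derived : ∀ {α β} → α ≻ β → MinModel Π I (gatom pref (ident α ∷ ident β ∷ []))
    pref-derived α≻β = derive _ (λ _ → ind 0) _ (inj₂ (inj₂ (_ , _ , α≻β , refl)))
      (λ c c∈ → _ , inj₂ (inj₂ (_ , _ , α≻β , refl)) , c∈) (λ _ ()) (λ _ ()) refl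

    eq-derived : ∀ {c} → PC c → MinModel Π I (gatom eqP (c ∷ c ∷ []))
    eq-derived {c} pc = fire (λ _ → c) (inj₁ equality∈) (λ _ → pc) ((λ _ ()) , (λ _ ()))

    acc-derived : ∀ {c} → PC c → ¬ I (gatom defeatedP (c ∷ [])) → MinModel Π I (gatom acc (c ∷ []))
    acc-derived {c} pc undefeated =
      fire (λ _ → c) (inj₁ accept∈) (λ _ → pc) ((λ _ ()) , λ { _ (here refl) → undefeated })

    data Step : GAtom → Set₁ where
      step-accept : ∀ {c} → PC c → ¬ I (gatom defeatedP (c ∷ [])) → Step (gatom acc (c ∷ []))
      step-equality : ∀ {c} → Step (gatom eqP (c ∷ c ∷ []))
      step-defeat : ∀ {s i} → s ∈ shapes → i < length s → ∀ σ →
        Body Π I σ (patterns s) (distinct s ++ preferredOver i s ++ attackersAttacked i s) →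
        Step (gatom defeatedP (σ (idVar i) ∷ []))
      step-attack : ∀ {s i} → s ∈ shapes → i < length s → ∀ σ →
        Body Π I σ (patterns s ++ attackersAccepted i s) (distinct s ++ preferredOver i s) →
        Step (gatom attackedP (σ (idVar i) ∷ []))
      step-conceptFact : ∀ {A′ a} → conceptAs A′ a ∈ A →
        Step (gatom (conceptP A′) (ind a ∷ ident (conceptAs A′ a) ∷ []))
      step-roleFact : ∀ {R a b} → roleAs R a b ∈ A →
        Step (gatom (roleP R) (ind a ∷ ind b ∷ ident (roleAs R a b) ∷ []))
      step-pref : ∀ {α β} → α ≻ β → Step (gatom pref (ident α ∷ ident β ∷ []))

    lastStep : ∀ {a} → MinModel Π I a → Step a
    lastStep (derive r σ a (inj₁ r∈) consts negs poss eq) with view r∈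
    lastStep (derive _ σ _ (inj₁ r∈) consts negs poss refl) | view-accept =
      step-accept (consts _ (here refl)) (negs _ (here refl))
    lastStep (derive _ σ _ (inj₁ r∈) consts negs poss refl) | view-equality = step-equality
    lastStep (derive _ σ _ (inj₁ r∈) consts negs poss refl) | view-defeat s i s∈ i< =
      step-defeat s∈ i< σ (unfire σ negs poss)
    lastStep (derive _ σ _ (inj₁ r∈) consts negs poss refl) | view-attack s i s∈ i< =
      step-attack s∈ i< σ (unfire σ negs poss)
    lastStep (derive _ σ _ (inj₂ (inj₁ (conceptAs _ _ , γ∈ , refl))) consts negs poss refl) =
      step-conceptFact γ∈
    lastStep (derive _ σ _ (inj₂ (inj₁ (roleAs _ _ _ , γ∈ , refl))) consts negs poss refl) =
      step-roleFact γ∈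
    lastStep (derive _ σ _ (inj₂ (inj₂ (_ , _ , α≻β , refl))) consts negs poss refl) = step-pref α≻β

    conceptFact-inv : ∀ {A′ c₁ c₂} → MinModel Π I (gatom (conceptP A′) (c₁ ∷ c₂ ∷ [])) →
      ∃[ a ] c₁ ≡ ind a × c₂ ≡ ident (conceptAs A′ a) × conceptAs A′ a ∈ A
    conceptFact-inv d with lastStep d
    ... | step-conceptFact γ∈ = _ , refl , refl , γ∈

    roleFact-inv : ∀ {R c₁ c₂ c₃} → MinModel Π I (gatom (roleP R) (c₁ ∷ c₂ ∷ c₃ ∷ [])) →
      ∃[ a ] ∃[ b ] c₁ ≡ ind a × c₂ ≡ ind b × c₃ ≡ ident (roleAs R a b) × roleAs R a b ∈ A
    roleFact-inv d with lastStep d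
    ... | step-roleFact γ∈ = _ , _ , refl , refl , refl , γ∈

    eq-inv : ∀ {c d} → MinModel Π I (gatom eqP (c ∷ d ∷ [])) → c ≡ d
    eq-inv d with lastStep d
    ... | step-equality = refl

    pref-inv : ∀ {α β} → MinModel Π I (gatom pref (ident α ∷ ident β ∷ [])) → α ≻ β
    pref-inv d with lastStep d
    ... | step-pref α≻β = α≻β

    acc-inv : ∀ {c} → MinModel Π I (gatom acc (c ∷ [])) → PC c × ¬ I (gatom defeatedP (c ∷ []))
    acc-inv d with lastStep d
    ... | step-accept pc undefeated = pc , undefeated

    record RuleInstance (c : Const) (ps ns : List Assertion → ℕ → List VarAtom) : Set₁ where
      field
        s : List Assertion
        s∈ : s ∈ shapes
        i : ℕ
        i< : i < length s
        σ : ℕ → Const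
        σi≡c : σ (idVar i) ≡ c
        body : Body Π I σ (ps s i) (ns s i)

    defeat-inv : ∀ {c} → MinModel Π I (gatom defeatedP (c ∷ [])) →
      RuleInstance c (λ s i → patterns s) (λ s i → distinct s ++ preferredOver i s ++ attackersAttacked i s)
    defeat-inv d with lastStep d
    ... | step-defeat s∈ i< σ body = record { s∈ = s∈ ; i< = i< ; σ = σ ; σi≡c = refl ; body = body }

    attack-inv : ∀ {c} → MinModel Π I (gatom attackedP (c ∷ [])) →
      RuleInstance c (λ s i → patterns s ++ attackersAccepted i s) (λ s i → distinct s ++ preferredOver i s)
    attack-inv d with lastStep d
    ... | step-attack s∈ i< σ body = record { s∈ = s∈ ; i< = i< ; σ = σ ; σi≡c = refl ; body = body }

unind : Const → ℕ
unind (ind n) = n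
unind _ = 0

ind-unind : ∀ {c a} → c ≡ ind a → c ≡ ind (unind c)
ind-unind refl = refl

nth-All : ∀ {X : Set} {P : X → Set} {d} xs {k} → All P xs → P d → P (nth d xs k)
nth-All [] [] pd = pd
nth-All (x ∷ xs) {zero} (px ∷ _) _ = px
nth-All (x ∷ xs) {suc k} (_ ∷ pxs) pd = nth-All xs pxs pd

-- EqPrefSound/Complete state that an interpretation contains
-- exactly the true eq- and pref-atoms; all iterates I_{j+1} satisfy both.
module Correspondence (em : EM) (T : TBox) (A : ABox) (_≻_ : Assertion → Assertion → Set)
                      (priority : IsPriority T A _≻_) where
  open Semantics em T A _≻_ priority public

  EqPrefSound EqPrefComplete : (GAtom → Set) → Set
  EqPrefSound I = (∀ c d → I (gatom eqP (c ∷ d ∷ [])) → c ≡ d) ×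
                  (∀ α β → I (gatom pref (ident α ∷ ident β ∷ [])) → α ≻ β)
  EqPrefComplete I = (∀ c → PC c → I (gatom eqP (c ∷ c ∷ []))) ×
                     (∀ α β → α ≻ β → I (gatom pref (ident α ∷ ident β ∷ [])))

  Attack : List Assertion → Assertion → Set₁
  Attack = SuccAttack T A _≻_

  pattern-ground : ∀ σ g k γ → σ (idVar k) ≡ ident (rename g γ) →
    (∀ v → v ∈ individuals γ → σ v ≡ ind (g v)) → ground σ (assertionPattern k γ) ≡ idGAtom (rename g γ)
  pattern-ground σ g k (conceptAs A′ v) σk σv rewrite σk | σv v (here refl) = refl
  pattern-ground σ g k (roleAs R v w) σk σv rewrite σk | σv v (here refl) | σv w (there (here refl)) = refl

  -- From a fired rule instance to a successful attack: the patterns are matched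
  -- by facts of A (through the renaming g), the negated eq-atoms force g to be
  -- injective, so the matched ABox is a conflict, and the negated pref-atoms
  -- make the attack successful.
  module Decode {I J : GAtom → Set} (complete : EqPrefComplete I) {s} (s∈ : s ∈ shapes) {i} (i< : i < length s)
    (σ : ℕ → Const) (facts : ∀ x → x ∈ patterns s → MinModel Π J (ground σ x))
    (distinct-false : ∀ x → x ∈ distinct s → ¬ I (ground σ x))
    (pref-false : ∀ x → x ∈ preferredOver i s → ¬ I (ground σ x)) where

    g : ℕ → ℕ
    g v = unind (σ v)

    at : ℕ → Assertion
    at = nth anyAssertion s

    Matched : ℕ → Assertion → Set
    Matched k γ = rename g γ ∈ A × σ (idVar k) ≡ ident (rename g γ) ×
                  (∀ v → v ∈ individuals γ → σ v ≡ ind (g v))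

    matched : ∀ k γ → MinModel Π J (ground σ (assertionPattern k γ)) → Matched k γ
    matched k (conceptAs A′ v) d with conceptFact-inv d
    ... | a , σv≡ , σk≡ , γ∈ rewrite σv≡ = γ∈ , σk≡ , λ { _ (here refl) → ind-unind σv≡ }
    matched k (roleAs R v w) d with roleFact-inv d
    ... | a , b , σv≡ , σw≡ , σk≡ , γ∈ rewrite σv≡ | σw≡ =
      γ∈ , σk≡ , λ { _ (here refl) → ind-unind σv≡ ; _ (there (here refl)) → ind-unind σw≡ }

    matched-at : ∀ {k} → k < length s → Matched k (at k)
    matched-at {k} k< = matched k (at k) (facts _ (patterns-∈⁺ s k<))

    σ-individual : ∀ {v} → v ∈ individualsₗ s → σ v ≡ ind (g v) × PC (σ v)
    σ-individual v∈ with individualsₗ-∈⁻ s v∈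
    ... | γ , γ∈ , v∈γ with ∈-nth anyAssertion s γ∈
    ...   | k , k< , refl with matched-at k<
    ...     | γ′∈A , _ , σ≡ =
      σ≡ _ v∈γ , subst PC (sym (σ≡ _ v∈γ)) (PC-ind γ′∈A (individuals-rename⁺ g (at k) v∈γ))

    g-injective : InjectiveOn g (individualsₗ s)
    g-injective {u} {v} u∈ v∈ gu≡gv with u ≟ v
    ... | yes u≡v = u≡v
    ... | no u≢v = ⊥-elim (distinct-false _ (distinct-∈⁺ s u∈ v∈ u≢v)
                     (subst (λ z → I (gatom eqP (σ u ∷ z ∷ []))) σu≡σv
                            (proj₁ complete (σ u) (proj₂ (σ-individual u∈)))))
      where
      σu≡σv : σ u ≡ σ v
      σu≡σv = trans (proj₁ (σ-individual u∈)) (trans (cong ind gu≡gv) (sym (proj₁ (σ-individual v∈))))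

    attack : List Assertion
    attack = map (rename g) s

    target : Assertion
    target = rename g (at i)

    target-id : σ (idVar i) ≡ ident target
    target-id = proj₁ (proj₂ (matched-at i<))

    position : ∀ {β} → β ∈ attack → ∃[ k ] k < length s × β ≡ rename g (at k)
    position β∈ with ∈-map⁻ (rename g) β∈
    ... | γ , γ∈ , refl with ∈-nth anyAssertion s γ∈
    ...   | k , k< , refl = k , k< , refl

    attack⊆A : attack ⊆ A
    attack⊆A β∈ with position β∈
    ... | k , k< , refl = proj₁ (matched-at k<)

    attacker-id : ∀ {β} → β ∈ attack → β ≢ target → ∃[ k ] k ∈ others i s × σ (idVar k) ≡ ident β
    attacker-id β∈ β≢ with position β∈
    ... | k , k< , refl with k ≟ i
    ...   | yes refl = ⊥-elim (β≢ refl)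
    ...   | no k≢i = k , others-∈⁺ i s k< k≢i , proj₁ (proj₂ (matched-at k<))

    successful : Attack attack target
    successful = (attack⊆A , MinimalUnsat-rename T g s g-injective (proj₁ (shapes-∈⁻ s∈))) ,
                 ∈-map⁺ (rename g) (nth-∈ anyAssertion s i<) , unpreferred
      where
      unpreferred : ∀ β → β ∈ attack → β ≢ target → ¬ (target ≻ β)
      unpreferred β β∈ β≢ target≻β with attacker-id β∈ β≢
      ... | k , k∈ , σk≡ = pref-false _ (∈-map⁺ _ k∈)
        (subst₂ (λ x y → I (gatom pref (x ∷ y ∷ []))) (sym target-id) (sym σk≡) (proj₂ complete _ _ target≻β))

  -- From a successful attack to a rule instance: C is an instance of a shape
  -- via an injective renaming g; σ sends individual variables through g and
  -- identifier variables to the identifiers of the matching assertions.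
  module Encode {I : GAtom → Set} (sound : EqPrefSound I) {C α} (att : Attack C α) where
    private
      C⊆A : C ⊆ A
      C⊆A = proj₁ (proj₁ att)
      α∈C : α ∈ C
      α∈C = proj₁ (proj₂ att)
    open Instance (instanceOf C (proj₂ (proj₁ att))) public

    C′⊆A : C′ ⊆ A
    C′⊆A = C⊆A ∘ C′⊆C

    length-shape : length shape ≡ length C′
    length-shape = trans (sym (Listₚ.length-map (rename g) shape)) (cong length g-shape)

    private
      α-position : ∃[ k ] k < length C′ × nth α C′ k ≡ α
      α-position = ∈-nth α C′ (C⊆C′ α∈C)

    i : ℕ
    i = proj₁ α-position

    i< : i < length shape
    i< = subst (i <_) (sym length-shape) (proj₁ (proj₂ α-position))

    σ : ℕ → Const
    σ n with member? _≟_ n (individualsₗ shape)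
    ... | yes _ = ind (g n)
    ... | no _ = ident (nth α C′ (n ∸ individualBound))

    σ-individual : ∀ {v} → v ∈ individualsₗ shape → σ v ≡ ind (g v)
    σ-individual {v} v∈ with member? _≟_ v (individualsₗ shape)
    ... | yes _ = refl
    ... | no v∉ = ⊥-elim (v∉ v∈)

    σ-id : ∀ k → σ (idVar k) ≡ ident (nth α C′ k)
    σ-id k with member? _≟_ (idVar k) (individualsₗ shape)
    ... | no _ = cong (ident ∘ nth α C′) (ℕₚ.m+n∸m≡n individualBound k)
    ... | yes k∈ with individualsₗ-∈⁻ shape k∈
    ...   | γ , γ∈ , k∈γ = ⊥-elim (ℕₚ.m+n≮m individualBound k
            (All.lookup (proj₂ (All.lookup (proj₁ (proj₂ (shapes-∈⁻ shape∈))) γ∈)) k∈γ))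

    target-id : σ (idVar i) ≡ ident α
    target-id = trans (σ-id i) (cong ident (proj₂ (proj₂ α-position)))

    σ-PC : ∀ n → PC (σ n)
    σ-PC n with member? _≟_ n (individualsₗ shape)
    ... | no _ = PC-ident (nth-All C′ (All.tabulate C′⊆A) (C⊆A α∈C))
    ... | yes n∈ with individualsₗ-∈⁻ shape n∈
    ...   | γ , γ∈ , n∈γ = PC-ind (C′⊆A (subst (rename g γ ∈_) g-shape (∈-map⁺ (rename g) γ∈)))
                                  (individuals-rename⁺ g γ n∈γ)

    facts : ∀ J x → x ∈ patterns shape → MinModel Π J (ground σ x)
    facts J x x∈ with patterns-∈⁻ shape x∈
    ... | k , k< , refl =
      subst (MinModel Π J) (sym (pattern-ground σ g k γ (trans (σ-id k) (cong ident γ′≡)) σ-on-γ))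
            (fact-derived (subst (_∈ A) γ′≡ (C′⊆A (nth-∈ α C′ (subst (k <_) length-shape k<)))))
      where
      γ : Assertion
      γ = nth anyAssertion shape k
      γ′≡ : nth α C′ k ≡ rename g γ
      γ′≡ = trans (cong (λ xs → nth α xs k) (sym g-shape)) (nth-map anyAssertion α (rename g) shape k<)
      σ-on-γ : ∀ v → v ∈ individuals γ → σ v ≡ ind (g v)
      σ-on-γ v v∈ = σ-individual (individualsₗ-∈⁺ (nth-∈ anyAssertion shape k<) v∈)

    distinct-false : ∀ x → x ∈ distinct shape → ¬ I (ground σ x)
    distinct-false x x∈ holds with distinct-∈⁻ shape x∈
    ... | u , v , u∈ , v∈ , u≢v , refl = u≢v (g-injective u∈ v∈
      (cong unind (trans (sym (σ-individual u∈)) (trans (proj₁ sound _ _ holds) (σ-individual v∈)))))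

    attacker : ∀ {k} → k ∈ others i shape → ∃[ β ] β ∈ C × β ≢ α × σ (idVar k) ≡ ident β
    attacker {k} k∈ with others-∈⁻ i shape k∈
    ... | k< , k≢i = nth α C′ k , C′⊆C (nth-∈ α C′ k<′) , β≢α , σ-id k
      where
      k<′ : k < length C′
      k<′ = subst (k <_) length-shape k<
      β≢α : nth α C′ k ≢ α
      β≢α eq = k≢i (nth-injective α C′ unique k<′ (proj₁ (proj₂ α-position))
                                   (trans eq (sym (proj₂ (proj₂ α-position)))))

    pref-false : ∀ x → x ∈ preferredOver i shape → ¬ I (ground σ x)
    pref-false x x∈ holds with ∈-map⁻ _ x∈
    ... | k , k∈ , refl with attacker k∈
    ...   | β , β∈ , β≢α , σk≡ = proj₂ (proj₂ att) β β∈ β≢α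
            (proj₂ sound α β (subst₂ (λ a b → I (gatom pref (a ∷ b ∷ []))) target-id σk≡ holds))

  module _ {I : GAtom → Set} where

    encode-defeat : ∀ {C α} → EqPrefSound I → Attack C α →
      (∀ β → β ∈ C → β ≢ α → ¬ I (gatom attackedP (ident β ∷ []))) →
      MinModel Π I (gatom defeatedP (ident α ∷ []))
    encode-defeat sound att unattacked =
      subst (λ c → MinModel Π I (gatom defeatedP (c ∷ []))) target-id
        (fire σ (inj₁ (defeat∈ shape∈ i<)) σ-PC (facts I , negative))
      where
      open Encode {I} sound att
      negative : ∀ x → x ∈ distinct shape ++ preferredOver i shape ++ attackersAttacked i shape → ¬ I (ground σ x)
      negative x x∈ with ∈-++⁻ (distinct shape) x∈
      ... | inj₁ x∈d = distinct-false x x∈d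
      ... | inj₂ x∈′ with ∈-++⁻ (preferredOver i shape) x∈′
      ...   | inj₁ x∈p = pref-false x x∈p
      ...   | inj₂ x∈a with ∈-map⁻ _ x∈a
      ...     | k , k∈ , refl with attacker k∈
      ...       | β , β∈ , β≢α , σk≡ =
        unattacked β β∈ β≢α ∘ subst (λ c → I (gatom attackedP (c ∷ []))) σk≡

    encode-attack : ∀ {C α} → EqPrefSound I → Attack C α →
      (∀ β → β ∈ C → β ≢ α → MinModel Π I (accAtom β)) →
      MinModel Π I (gatom attackedP (ident α ∷ []))
    encode-attack sound att accepted =
      subst (λ c → MinModel Π I (gatom attackedP (c ∷ []))) target-id
        (fire σ (inj₁ (attack∈ shape∈ i<)) σ-PC (positive , negative))
      where
      open Encode {I} sound att
      positive : ∀ x → x ∈ patterns shape ++ attackersAccepted i shape → MinModel Π I (ground σ x)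
      positive x x∈ with ∈-++⁻ (patterns shape) x∈
      ... | inj₁ x∈p = facts I x x∈p
      ... | inj₂ x∈a with ∈-map⁻ _ x∈a
      ...   | k , k∈ , refl with attacker k∈
      ...     | β , β∈ , β≢α , σk≡ =
        subst (λ c → MinModel Π I (gatom acc (c ∷ []))) (sym σk≡) (accepted β β∈ β≢α)
      negative : ∀ x → x ∈ distinct shape ++ preferredOver i shape → ¬ I (ground σ x)
      negative x x∈ with ∈-++⁻ (distinct shape) x∈
      ... | inj₁ x∈d = distinct-false x x∈d
      ... | inj₂ x∈p = pref-false x x∈p

    decode-defeat : ∀ {c} → EqPrefComplete I → MinModel Π I (gatom defeatedP (c ∷ [])) →
      ∃[ α ] c ≡ ident α × ∃[ C ] Attack C α ×
             (∀ β → β ∈ C → β ≢ α → ¬ I (gatom attackedP (ident β ∷ [])))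
    decode-defeat complete d = target , trans (sym σi≡c) target-id , attack , successful , unattacked
      where
      open RuleInstance (defeat-inv d)
      negative : ∀ x → x ∈ distinct s ++ preferredOver i s ++ attackersAttacked i s → ¬ I (ground σ x)
      negative = proj₂ body
      open Decode {I} {I} complete s∈ i< σ (proj₁ body) (λ x → negative x ∘ ∈-++⁺ˡ)
                  (λ x → negative x ∘ ∈-++⁺ʳ (distinct s) ∘ ∈-++⁺ˡ)
      unattacked : ∀ β → β ∈ attack → β ≢ target → ¬ I (gatom attackedP (ident β ∷ []))
      unattacked β β∈ β≢ holds with attacker-id β∈ β≢
      ... | k , k∈ , σk≡ = negative _ (∈-++⁺ʳ (distinct s) (∈-++⁺ʳ (preferredOver i s) (∈-map⁺ _ k∈)))
                             (subst (λ c → I (gatom attackedP (c ∷ []))) (sym σk≡) holds)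

    decode-attack : ∀ {c} → EqPrefComplete I → MinModel Π I (gatom attackedP (c ∷ [])) →
      ∃[ α ] c ≡ ident α × ∃[ C ] Attack C α × (∀ β → β ∈ C → β ≢ α → MinModel Π I (accAtom β))
    decode-attack complete d = target , trans (sym σi≡c) target-id , attack , successful , accepted
      where
      open RuleInstance (attack-inv d)
      positive : ∀ x → x ∈ patterns s ++ attackersAccepted i s → MinModel Π I (ground σ x)
      positive = proj₁ body
      negative : ∀ x → x ∈ distinct s ++ preferredOver i s → ¬ I (ground σ x)
      negative = proj₂ body
      open Decode {I} {I} complete s∈ i< σ (λ x → positive x ∘ ∈-++⁺ˡ) (λ x → negative x ∘ ∈-++⁺ˡ)
                  (λ x → negative x ∘ ∈-++⁺ʳ (distinct s))
      accepted : ∀ β → β ∈ attack → β ≢ target → MinModel Π I (accAtom β)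
      accepted β β∈ β≢ with attacker-id β∈ β≢
      ... | k , k∈ , σk≡ = subst (λ c → MinModel Π I (gatom acc (c ∷ []))) σk≡
                             (positive _ (∈-++⁺ʳ (patterns s) (∈-map⁺ _ k∈)))

module WellFounded (em : EM) (T : TBox) (A : ABox) (_≻_ : Assertion → Assertion → Set)
                   (priority : IsPriority T A _≻_) where
  open Correspondence em T A _≻_ priority public
  open Grounded em T A _≻_ using (CounteredBy; Defended; Defended-mono; stage; grounded⇔stage)

  Acc : ℕ → Assertion → Set
  Acc j α = Iter Π j (accAtom α)

  -- Every iterate contains only true eq- and pref-atoms; every iterate after
  -- I_0 = ∅ contains all of them (they are facts or unconditional rules).
  iterate-sound : ∀ j → EqPrefSound (Iter Π j)
  iterate-sound zero = (λ _ _ ()) , (λ _ _ ())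
  iterate-sound (suc j) = (λ _ _ → eq-inv) , (λ _ _ → pref-inv)

  iterate-complete : ∀ j → EqPrefComplete (Iter Π (suc j))
  iterate-complete j = (λ _ → eq-derived) , (λ _ _ → pref-derived)

  accepted-if-defended : ∀ k α → Defended (Acc (suc k)) α → Acc (3 + k) α
  accepted-if-defended k α (α∈ , defend) = acc-derived (PC-ident α∈) undefeated
    where
    undefeated : ¬ Iter Π (2 + k) (gatom defeatedP (ident α ∷ []))
    undefeated defeat with decode-defeat (iterate-complete k) defeat
    ... | α′ , refl , C , att , unattacked with defend C att
    ...   | β , β∈ , β≢ , C′ , att′ , accepted =
      unattacked β β∈ β≢ (encode-attack (iterate-sound k) att′ accepted)

  defended-if-accepted : ∀ k α → Acc (4 + k) α → Defended (Acc (2 + k)) α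
  defended-if-accepted k α accepted with acc-inv accepted
  ... | pc , undefeated = PC-ident⁻ pc , counter
    where
    counter : ∀ C → Attack C α → ∃[ β ] (β ∈ C × β ≢ α × CounteredBy (Acc (2 + k)) β)
    counter C att with decide em (∃[ β ] (β ∈ C × β ≢ α × Iter Π (2 + k) (gatom attackedP (ident β ∷ []))))
    ... | no unattacked = ⊥-elim (undefeated (encode-defeat (iterate-sound (2 + k)) att
                                                (λ β β∈ β≢ attacked → unattacked (β , β∈ , β≢ , attacked))))
    ... | yes (β , β∈ , β≢ , attacked) with decode-attack (iterate-complete k) attacked
    ...   | β′ , refl , C′ , att′ , accepted = β , β∈ , β≢ , C′ , att′ , accepted

  accepted₂-unattacked : ∀ {ℓ} (P : Assertion → Set ℓ) α → Acc 2 α → Defended P α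
  accepted₂-unattacked P α accepted with acc-inv accepted
  ... | pc , undefeated =
    PC-ident⁻ pc , λ C att → ⊥-elim (undefeated (encode-defeat (iterate-sound 0) att (λ _ _ _ ())))

  stage→accepted : ∀ j α → stage j α → Acc (2 + 2 * j) α
  stage→accepted zero α ()
  stage→accepted (suc j) α in-stage = subst (λ n → Acc (2 + n) α) (sym (ℕₚ.*-suc 2 j))
    (accepted-if-defended (suc (2 * j)) α (Defended-mono (λ x _ → stage→accepted j x) in-stage))

  accepted→stage : ∀ j α → Acc (2 + 2 * j) α → stage (suc j) α
  accepted→stage zero α accepted = accepted₂-unattacked (stage zero) α accepted
  accepted→stage (suc j) α accepted = Defended-mono (λ x _ → accepted→stage j x)
    (defended-if-accepted (2 * j) α (subst (λ n → Acc (2 + n) α) (ℕₚ.*-suc 2 j) accepted))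

  grounded⇔wellFounded : ∀ α → InGrounded T A _≻_ α ⇔ WFTrue Π (accAtom α)
  grounded⇔wellFounded α = mk⇔
    (λ grounded → let j , in-stage = to (grounded⇔stage α) grounded in
                  suc j , subst (λ n → Acc n α) (sym (ℕₚ.*-suc 2 j)) (stage→accepted j α in-stage))
    λ { (zero , ())
      ; (suc j , accepted) → from (grounded⇔stage α)
          (suc j , accepted→stage j α (subst (λ n → Acc n α) (ℕₚ.*-suc 2 j) accepted)) }
    where open Equivalence

-- Theorem: Π_T captures the grounded extension under the well-founded semantics.
mainTheorem10 : ExcludedMiddle (lsuc 0ℓ) →
    (T : TBox) → Σ (List Rule) λ ΠT →
      (A : ABox) → NoSelfInconsistent T A →
      (_≻_ : Assertion → Assertion → Set) → IsPriority T A _≻_ →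
      (α : Assertion) →
        (InGrounded T A _≻_ α → WFTrue (FullProgram ΠT A _≻_) (accAtom α)) ×
        (WFTrue (FullProgram ΠT A _≻_) (accAtom α) → InGrounded T A _≻_ α)
mainTheorem10 em T = Program.ΠT em T , λ A _ _≻_ priority α →
  let open WellFounded em T A _≻_ priority in
  Equivalence.to (grounded⇔wellFounded α) , Equivalence.from (grounded⇔wellFounded α)
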